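{- (1) $\mathsf{SRT}^2_2\le_\mathrm{W}\mathsf{LPO}\ast\mathsf{wRSgr}$. (2) $\mathsf{SRT}^2_2\le_\mathrm{W}(\mathsf{LPO}\times\mathsf{LPO})\ast\mathsf{wRSg}$.
   Context: Problems are multi-valued partial functions $\subseteq\omega^\omega\rightrightarrows\omega^\omega$ with standard codings. $\mathcal{F}\le_\mathrm{W}\mathcal{G}$ if there are Turing functionals $\Phi,\Psi$ with $\Phi(f)\in\mathrm{dom}(\mathcal{G})$ for all $f\in\mathrm{dom}(\mathcal{F})$ and $\Psi(\langle f,g\rangle)\in\mathcal{F}(f)$ for all $f\in\mathrm{dom}(\mathcal F)$, $g\in\mathcal{G}(\Phi(f))$. The compositional product $\mathcal F\ast\mathcal G$ is (up to Weihrauch equivalence) the $\le_\mathrm{W}$-maximum of the set of compositions $\mathcal F_0\circ\mathcal G_0$ with $\mathcal F_0\le_\mathrm W\mathcal F$, $\mathcal G_0\le_\mathrm W\mathcal G$ composable; in particular $\mathcal H\le_\mathrm W\mathcal F\ast\mathcal G$ holds if there are Turing functionals $\Phi,\Theta,\Psi$ such that for every $p\in\mathrm{dom}(\mathcal H)$: $\Phi(p)\in\mathrm{dom}(\mathcal G)$; $\Theta(\langle p,q\rangle)\in\mathrm{dom}(\mathcal F)$ for all $q\in\mathcal G(\Phi(p))$; and $\Psi(\langle\langle p,q\rangle,r\rangle)\in\mathcal H(p)$ for all such $q$ and all $r\in\mathcal F(\Theta(\langle p,q\rangle))$. $\mathcal F\times\mathcal G$ takes pairs of inputs and returns pairs of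 solutions. $\mathsf{LPO}$: input $p\in\omega^\omega$; output $0$ if $p(n)=0$ for some $n$, and $1$ otherwise. $\mathsf{SRT}^2_2$: input a stable $c\colon[\omega]^2\to\{0,1\}$ ($\lim_sc(n,s)$ exists for each $n$); output an infinite $H$ with $c$ constant on $[H]^2$. Graphs $G=(V,E)$ are simple with $V\subseteq\omega$ infinite, $E\subseteq[V]^2$; $N(v)=\{y:(v,y)\in E\}$. $\mathsf{wRSg}$: input an infinite graph; output an infinite $H\subseteq V$ with, for all $v\in H$, $|H\cap N(v)|=\omega$ or $|H\cap N(v)|\le1$. $\mathsf{wRSgr}$: same input; output an infinite $H\subseteq V$ with, for all $v\in H$, $|H\cap N(v)|=\omega$ or $|H\cap N(v)|=0$. -}

module Defs where

open import Data.Nat using (ℕ; zero; suc; _+_; _*_; _≤_; _<_)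
open import Data.Fin using (Fin)
open import Data.Vec using (Vec; []; _∷_; lookup)
open import Data.Maybe using (Maybe; just; nothing)
open import Data.Product using (Σ; ∃; _×_; _,_)
open import Data.Sum using (_⊎_)
open import Data.Unit using (⊤)
open import Relation.Binary.PropositionalEquality using (_≡_)
open import Relation.Nullary using (¬_)

Baire : Set
Baire = ℕ → ℕ

-- Turing functionals: partial recursive functions relative to an oracle
-- f : Baire (Kleene's μ-recursive schemes with an oracle function).

data Code : ℕ → Set where
  zer  : ∀ {k} → Code k
  succ : Code 1
  proj : ∀ {k} → Fin k → Code k
  orc  : Code 1
  comp : ∀ {k m} → Code m → Vec (Code k) m → Code k
  prec : ∀ {k} → Code k → Code (suc (suc k)) → Code (suc k)
  mu   : ∀ {k} → Code (suc k) → Code k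

bindM : Maybe ℕ → (ℕ → Maybe ℕ) → Maybe ℕ
bindM nothing  _ = nothing
bindM (just x) k = k x

-- fuel-bounded evaluation (monotone in the fuel)
mutual
  eval : ℕ → Baire → ∀ {k} → Code k → Vec ℕ k → Maybe ℕ
  eval zero    f c xs = nothing
  eval (suc n) f zer xs = just 0
  eval (suc n) f succ (x ∷ []) = just (suc x)
  eval (suc n) f (proj i) xs = just (lookup xs i)
  eval (suc n) f orc (x ∷ []) = just (f x)
  eval (suc n) f (comp g hs) xs = bindV (evalV n f hs xs) (eval n f g)
  eval (suc n) f (prec g h) (zero ∷ xs) = eval n f g xs
  eval (suc n) f (prec g h) (suc y ∷ xs) =
    bindM (eval n f (prec g h) (y ∷ xs)) (λ r → eval n f h (y ∷ r ∷ xs))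
  eval (suc n) f (mu g) xs = search n f g xs 0

  evalV : ℕ → Baire → ∀ {k m} → Vec (Code k) m → Vec ℕ k → Maybe (Vec ℕ m)
  evalV n f [] xs = just []
  evalV n f (c ∷ cs) xs with eval n f c xs
  ... | nothing = nothing
  ... | just y with evalV n f cs xs
  ...   | nothing = nothing
  ...   | just ys = just (y ∷ ys)

  search : ℕ → Baire → ∀ {k} → Code (suc k) → Vec ℕ k → ℕ → Maybe ℕ
  search zero f g xs i = nothing
  search (suc n) f g xs i with eval n f g (i ∷ xs)
  ... | nothing = nothing
  ... | just zero = just i
  ... | just (suc _) = search n f g xs (suc i)

  bindV : ∀ {m} → Maybe (Vec ℕ m) → (Vec ℕ m → Maybe ℕ) → Maybe ℕ
  bindV nothing  _ = nothing
  bindV (just v) k = k v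

TuringFunctional : Set
TuringFunctional = Code 1

_⟦_⟧≡_ : TuringFunctional → Baire → Baire → Set
Φ ⟦ f ⟧≡ g = ∀ n → ∃ λ s → eval s f Φ (n ∷ []) ≡ just (g n)

⟨_,_⟩ : Baire → Baire → Baire
⟨ f , g ⟩ zero = f 0
⟨ f , g ⟩ (suc zero) = g 0
⟨ f , g ⟩ (suc (suc n)) = ⟨ (λ x → f (suc x)) , (λ x → g (suc x)) ⟩ n

π₀ π₁ : Baire → Baire
π₀ p n = p (2 * n)
π₁ p n = p (suc (2 * n))

tri : ℕ → ℕ
tri zero = 0
tri (suc n) = tri n + suc n

pairℕ : ℕ → ℕ → ℕ
pairℕ x y = tri (x + y) + y

record Problem : Set₁ where
  field
    dom : Baire → Set
    sol : Baire → Baire → Set   -- sol p q : q ∈ F(p)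
open Problem public

_≤W_ : Problem → Problem → Set
F ≤W G = Σ TuringFunctional λ Φ → Σ TuringFunctional λ Ψ →
  ∀ f → dom F f →
    Σ Baire λ g → Φ ⟦ f ⟧≡ g × dom G g ×
      (∀ r → sol G g r → Σ Baire λ h → Ψ ⟦ ⟨ f , r ⟩ ⟧≡ h × sol F f h)

-- H ≤W F ∗ G (compositional product), via the standard characterisation
_≤W_∗_ : Problem → Problem → Problem → Set
H ≤W F ∗ G = Σ TuringFunctional λ Φ → Σ TuringFunctional λ Θ →
  Σ TuringFunctional λ Ψ →
  ∀ p → dom H p →
    Σ Baire λ x → Φ ⟦ p ⟧≡ x × dom G x ×
      (∀ q → sol G x q →
        Σ Baire λ y → Θ ⟦ ⟨ p , q ⟩ ⟧≡ y × dom F y ×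
          (∀ r → sol F y r →
            Σ Baire λ h → Ψ ⟦ ⟨ ⟨ p , q ⟩ , r ⟩ ⟧≡ h × sol H p h))

_×P_ : Problem → Problem → Problem
dom (F ×P G) p = dom F (π₀ p) × dom G (π₁ p)
sol (F ×P G) p q = sol F (π₀ p) (π₀ q) × sol G (π₁ p) (π₁ q)

-- sets coded by characteristic functions
IsSet : Baire → Set
IsSet h = ∀ n → h n ≤ 1

_∈S_ : ℕ → Baire → Set
x ∈S h = h x ≡ 1

InfiniteS : Baire → Set
InfiniteS h = ∀ n → ∃ λ m → n ≤ m × m ∈S h

-- LPO (output coded as the first value of the output sequence)
LPO : Problem
dom LPO p = ⊤
sol LPO p r = (r 0 ≡ 0 × ∃ λ n → p n ≡ 0) ⊎ (r 0 ≡ 1 × (∀ n → ¬ p n ≡ 0))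

-- SRT²₂ : colour of {x<y} is p ⟨x,y⟩
col : Baire → ℕ → ℕ → ℕ
col p x y = p (pairℕ x y)

SRT22 : Problem
dom SRT22 p = (∀ x y → x < y → col p x y ≤ 1) ×
              (∀ x → ∃ λ i → ∃ λ s₀ → ∀ s → s₀ ≤ s → x < s → col p x s ≡ i)
sol SRT22 p h = IsSet h × InfiniteS h ×
  (∃ λ i → ∀ x y → x < y → x ∈S h → y ∈S h → col p x y ≡ i)

Vx : Baire → ℕ → Set
Vx p x = p (pairℕ 0 x) ≡ 1

Ex : Baire → ℕ → ℕ → Set
Ex p x y = p (pairℕ 1 (pairℕ x y)) ≡ 1

IsInfGraph : Baire → Set
IsInfGraph p = (∀ x → p (pairℕ 0 x) ≤ 1) ×
               (∀ x y → p (pairℕ 1 (pairℕ x y)) ≤ 1) ×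
               (∀ x → ¬ Ex p x x) ×
               (∀ x y → Ex p x y → Ex p y x) ×
               (∀ x y → Ex p x y → Vx p x × Vx p y) ×
               (∀ n → ∃ λ m → n ≤ m × Vx p m)

InfNbhd : Baire → Baire → ℕ → Set
InfNbhd p h v = ∀ n → ∃ λ m → n ≤ m × m ∈S h × Ex p v m

wRSg : Problem
dom wRSg p = IsInfGraph p
sol wRSg p h = IsSet h × (∀ x → x ∈S h → Vx p x) × InfiniteS h ×
  (∀ v → v ∈S h → InfNbhd p h v ⊎
     (∀ a b → a ∈S h → Ex p v a → b ∈S h → Ex p v b → a ≡ b))

wRSgr : Problem
dom wRSgr p = IsInfGraph p
sol wRSgr p h = IsSet h × (∀ x → x ∈S h → Vx p x) × InfiniteS h ×
  (∀ v → v ∈S h → InfNbhd p h v ⊎ (∀ a → a ∈S h → ¬ Ex p v a))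

module Submission where

-- Colour 1 makes the colouring a graph on ℕ. Given an infinite set H returned by wRSgr, LPO decides
-- whether H contains an edge. If not, H is 0-homogeneous. If a < b is one, call a point of H a candidate
-- when it is a or adjacent to a, and b or adjacent to b. A candidate has a neighbour in H, hence infinitely
-- many, so by stability its limit colour is 1. Going up from b, choose every point of H adjacent to all
-- candidates up to the last point chosen: the chosen points are candidates pairwise of colour 1, and there
-- are infinitely many since finitely many candidates are eventually joined with colour 1 to everything.
-- For wRSg, one LPO instance asks for a path c - a - b - d in H, which serves the same purpose, since
-- each candidate then has two neighbours in H; the other asks for a point v with two neighbours in H.
-- Without such a path every point of H ∖ {v} has at most one neighbour there (one with infinitely many
-- would, together with v, produce such a path), and the points of H ∖ {v} with no smaller neighbour
-- form an infinite 0-homogeneous set. The functionals evaluate formulas with bounded quantifiers,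
-- compiled to μ-recursive codes; the witnesses a, b, v come from unbounded searches, which stop at once
-- when LPO has answered that there is none.

open import Defs
open import Data.Bool using (Bool; true; false; _∧_; _∨_; not; if_then_else_; T)
open import Data.Bool.Properties using (T-∧)
open import Data.Empty using (⊥; ⊥-elim)
open import Data.Fin using (Fin; toℕ; fromℕ<) renaming (zero to fz; suc to fs)
open import Data.Fin.Properties using (pigeonhole; toℕ-fromℕ<)
open import Function using (_∘_; Equivalence)
open import Data.Maybe using (just)
open import Data.Nat using (ℕ; zero; suc; _+_; _*_; _∸_; _≤_; _<_; z≤n; s≤s; _⊔_; pred; _≡ᵇ_; _<ᵇ_)
open import Data.Nat.Properties
open import Data.Product using (Σ; ∃; _×_; _,_; proj₁; proj₂)
open import Data.Sum using (_⊎_; inj₁; inj₂)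
open import Data.Unit using (⊤; tt)
open import Data.Vec using (Vec; []; _∷_; lookup; tabulate)
open import Data.Vec.Properties using (tabulate∘lookup)
open import Relation.Binary.PropositionalEquality
open import Relation.Binary.Definitions using (tri<; tri≈; tri>)
open import Relation.Nullary using (¬_; Dec; yes; no; does)
open import Relation.Nullary.Decidable using (map′; _×-dec_; _⊎-dec_; ¬?)

mutual
  μ-free : ∀ {k} → Code k → Bool
  μ-free zer         = true
  μ-free succ        = true
  μ-free (proj i)    = true
  μ-free orc         = true
  μ-free (comp g hs) = μ-free g ∧ μ-freeⱽ hs
  μ-free (prec g h)  = μ-free g ∧ μ-free h
  μ-free (mu g)      = false

  μ-freeⱽ : ∀ {k m} → Vec (Code k) m → Bool
  μ-freeⱽ []       = true
  μ-freeⱽ (c ∷ cs) = μ-free c ∧ μ-freeⱽ cs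

-- The value of a μ-free code; the `mu` clause is junk.
mutual
  denote : ∀ {k} → Code k → Baire → Vec ℕ k → ℕ
  denote zer         f xs       = 0
  denote succ        f (x ∷ []) = suc x
  denote (proj i)    f xs       = lookup xs i
  denote orc         f (x ∷ []) = f x
  denote (comp g hs) f xs       = denote g f (denoteⱽ hs f xs)
  denote (prec g h)  f (y ∷ xs) = denoteRec g h f y xs
  denote (mu g)      f xs       = 0

  denoteⱽ : ∀ {k m} → Vec (Code k) m → Baire → Vec ℕ k → Vec ℕ m
  denoteⱽ []       f xs = []
  denoteⱽ (c ∷ cs) f xs = denote c f xs ∷ denoteⱽ cs f xs

  denoteRec : ∀ {k} → Code k → Code (suc (suc k)) → Baire → ℕ → Vec ℕ k → ℕ
  denoteRec g h f zero    xs = denote g f xs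
  denoteRec g h f (suc y) xs = denote h f (y ∷ denoteRec g h f y xs ∷ xs)

mutual
  eval-suc : ∀ n f {k} (c : Code k) xs {v} → eval n f c xs ≡ just v → eval (suc n) f c xs ≡ just v
  eval-suc zero    f c xs ()
  eval-suc (suc n) f zer xs e = e
  eval-suc (suc n) f succ (x ∷ []) e = e
  eval-suc (suc n) f (proj i) xs e = e
  eval-suc (suc n) f orc (x ∷ []) e = e
  eval-suc (suc n) f (comp g hs) xs e with evalV n f hs xs in eq
  ... | just ys rewrite evalⱽ-suc n f hs xs eq = eval-suc n f g ys e
  eval-suc (suc n) f (prec g h) (zero ∷ xs) e = eval-suc n f g xs e
  eval-suc (suc n) f (prec g h) (suc y ∷ xs) e with eval n f (prec g h) (y ∷ xs) in eq
  ... | just r rewrite eval-suc n f (prec g h) (y ∷ xs) eq = eval-suc n f h (y ∷ r ∷ xs) e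
  eval-suc (suc n) f (mu g) xs e = search-suc n f g xs 0 e

  evalⱽ-suc : ∀ n f {k m} (cs : Vec (Code k) m) xs {vs} → evalV n f cs xs ≡ just vs → evalV (suc n) f cs xs ≡ just vs
  evalⱽ-suc n f [] xs e = e
  evalⱽ-suc n f (c ∷ cs) xs e with eval n f c xs in eq₁
  ... | just y with evalV n f cs xs in eq₂
  ...   | just ys rewrite eval-suc n f c xs eq₁ | evalⱽ-suc n f cs xs eq₂ = e

  search-suc : ∀ n f {k} (g : Code (suc k)) xs i {v} → search n f g xs i ≡ just v → search (suc n) f g xs i ≡ just v
  search-suc zero    f g xs i ()
  search-suc (suc n) f g xs i e with eval n f g (i ∷ xs) in eq
  ... | just zero    rewrite eval-suc n f g (i ∷ xs) eq = e
  ... | just (suc w) rewrite eval-suc n f g (i ∷ xs) eq = search-suc n f g xs (suc i) e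

mono-by-step : ∀ {P : ℕ → Set} → (∀ n → P n → P (suc n)) → ∀ {m n} → m ≤ n → P m → P n
mono-by-step {P} step m≤n pm = go (≤⇒≤′ m≤n)
  where
  open Data.Nat using (_≤′_; ≤′-refl; ≤′-step)
  go : ∀ {n} → _ ≤′ n → P n
  go ≤′-refl      = pm
  go (≤′-step le) = step _ (go le)

eval-mono : ∀ f {k} (c : Code k) xs {v m n} → m ≤ n → eval m f c xs ≡ just v → eval n f c xs ≡ just v
eval-mono f c xs = mono-by-step (λ n → eval-suc n f c xs)

evalⱽ-mono : ∀ f {k j} (cs : Vec (Code k) j) xs {vs m n} → m ≤ n → evalV m f cs xs ≡ just vs → evalV n f cs xs ≡ just vs
evalⱽ-mono f cs xs = mono-by-step (λ n → evalⱽ-suc n f cs xs)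

Converges : Baire → ∀ {k} → Code k → Vec ℕ k → ℕ → Set
Converges f c xs v = ∃ λ s → eval s f c xs ≡ just v

Convergesⱽ : Baire → ∀ {k m} → Vec (Code k) m → Vec ℕ k → Vec ℕ m → Set
Convergesⱽ f cs xs vs = ∃ λ s → evalV s f cs xs ≡ just vs

converges-[] : ∀ f {k} (xs : Vec ℕ k) → Convergesⱽ f [] xs []
converges-[] f xs = 0 , refl

converges-∷ : ∀ f {k m} {c : Code k} {cs : Vec (Code k) m} {xs v vs} →
  Converges f c xs v → Convergesⱽ f cs xs vs → Convergesⱽ f (c ∷ cs) xs (v ∷ vs)
converges-∷ f {c = c} {cs} {xs} {v} {vs} (s₁ , e₁) (s₂ , e₂) = s₁ ⊔ s₂ , both
  where
  both : evalV (s₁ ⊔ s₂) f (c ∷ cs) xs ≡ just (v ∷ vs)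
  both rewrite eval-mono f c xs (m≤m⊔n s₁ s₂) e₁ | evalⱽ-mono f cs xs (m≤n⊔m s₁ s₂) e₂ = refl

converges-comp : ∀ f {k m} {g : Code m} {hs : Vec (Code k) m} {xs vs v} →
  Convergesⱽ f hs xs vs → Converges f g vs v → Converges f (comp g hs) xs v
converges-comp f {g = g} {hs} {xs} {vs} {v} (s₁ , e₁) (s₂ , e₂) = suc (s₁ ⊔ s₂) , both
  where
  both : eval (suc (s₁ ⊔ s₂)) f (comp g hs) xs ≡ just v
  both rewrite evalⱽ-mono f hs xs (m≤m⊔n s₁ s₂) e₁ = eval-mono f g vs (m≤n⊔m s₁ s₂) e₂

mutual
  μ-free⇒converges : ∀ f {k} (c : Code k) → T (μ-free c) → ∀ xs → Converges f c xs (denote c f xs)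
  μ-free⇒converges f zer t xs = 1 , refl
  μ-free⇒converges f succ t (x ∷ []) = 1 , refl
  μ-free⇒converges f (proj i) t xs = 1 , refl
  μ-free⇒converges f orc t (x ∷ []) = 1 , refl
  μ-free⇒converges f (comp g hs) t xs =
    converges-comp f (μ-free⇒convergesⱽ f hs (proj₂ (Equivalence.to (T-∧ {μ-free g}) t)) xs)
                     (μ-free⇒converges f g (proj₁ (Equivalence.to T-∧ t)) _)
  μ-free⇒converges f (prec g h) t (y ∷ xs) =
    prec-converges f g h (proj₁ (Equivalence.to T-∧ t)) (proj₂ (Equivalence.to (T-∧ {μ-free g}) t)) y xs

  μ-free⇒convergesⱽ : ∀ f {k m} (cs : Vec (Code k) m) → T (μ-freeⱽ cs) → ∀ xs → Convergesⱽ f cs xs (denoteⱽ cs f xs)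
  μ-free⇒convergesⱽ f [] t xs = converges-[] f xs
  μ-free⇒convergesⱽ f (c ∷ cs) t xs =
    converges-∷ f (μ-free⇒converges f c (proj₁ (Equivalence.to T-∧ t)) xs)
                  (μ-free⇒convergesⱽ f cs (proj₂ (Equivalence.to (T-∧ {μ-free c}) t)) xs)

  prec-converges : ∀ f {k} (g : Code k) h → T (μ-free g) → T (μ-free h) →
    ∀ y xs → Converges f (prec g h) (y ∷ xs) (denoteRec g h f y xs)
  prec-converges f g h tg th zero xs with μ-free⇒converges f g tg xs
  ... | s , e = suc s , e
  prec-converges f g h tg th (suc y) xs
    with prec-converges f g h tg th y xs | μ-free⇒converges f h th (y ∷ denoteRec g h f y xs ∷ xs)
  ... | s₁ , e₁ | s₂ , e₂ = suc (s₁ ⊔ s₂) , step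
    where
    step : eval (suc (s₁ ⊔ s₂)) f (prec g h) (suc y ∷ xs) ≡ just (denoteRec g h f (suc y) xs)
    step rewrite eval-mono f (prec g h) (y ∷ xs) (m≤m⊔n s₁ s₂) e₁ = eval-mono f h _ (m≤n⊔m s₁ s₂) e₂

module _ (f : Baire) {k} (g : Code (suc k)) (μ-free-g : T (μ-free g)) (xs : Vec ℕ k) where

  private
    value : ℕ → ℕ
    value i = denote g f (i ∷ xs)

    CommonFuel : ℕ → ℕ → Set
    CommonFuel N S = ∀ i → i ≤ N → eval S f g (i ∷ xs) ≡ just (value i)

    common-fuel : ∀ N → ∃ (CommonFuel N)
    common-fuel zero with μ-free⇒converges f g μ-free-g (0 ∷ xs)
    ... | s , e = s , λ { .0 z≤n → e }
    common-fuel (suc N) with common-fuel N | μ-free⇒converges f g μ-free-g (suc N ∷ xs)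
    ... | S , below | s , e = S ⊔ s , at
      where
      at : CommonFuel (suc N) (S ⊔ s)
      at i i≤1+N with m≤n⇒m<n∨m≡n i≤1+N
      ... | inj₁ (s≤s i≤N) = eval-mono f g _ (m≤m⊔n S s) (below i i≤N)
      ... | inj₂ refl      = eval-mono f g _ (m≤n⊔m S s) e

    search-stops : ∀ {i₀ S} → CommonFuel i₀ S → value i₀ ≡ 0 →
      ∀ d i → i + d ≡ i₀ → ∃ λ m → search (suc (d + S)) f g xs i ≡ just m × value m ≡ 0
    search-stops {i₀} {S} fuel zero-at d i i+d≡i₀
      rewrite eval-mono f g (i ∷ xs) (m≤n+m S d) (fuel i (subst (i ≤_) i+d≡i₀ (m≤m+n i d)))
      with value i in eq | d
    ... | zero  | _ = i , refl , eq
    ... | suc _ | zero rewrite +-identityʳ i | i+d≡i₀ with () ← trans (sym eq) zero-at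
    ... | suc _ | suc d′ = search-stops fuel zero-at d′ (suc i) (trans (sym (+-suc i d′)) i+d≡i₀)

  -- Callers only use the existence of the first zero, and unfolding the search during type checking is costly.
  opaque
    mu-converges : ∀ i₀ → denote g f (i₀ ∷ xs) ≡ 0 → ∃ λ m → Converges f (mu g) xs m × denote g f (m ∷ xs) ≡ 0
    mu-converges i₀ zero-at with common-fuel i₀
    ... | S , fuel with search-stops fuel zero-at i₀ 0 refl
    ...   | m , stops , zero-m = m , (suc (suc (i₀ + S)) , stops) , zero-m

-- Terms and formulas over j oracles and k variables

natrec : ℕ → (ℕ → ℕ → ℕ) → ℕ → ℕ
natrec z s zero    = z
natrec z s (suc n) = s n (natrec z s n)

any≤? : ∀ {P : ℕ → Set} → (∀ i → Dec (P i)) → ∀ n → Dec (∃ λ i → i ≤ n × P i)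
any≤? P? zero    = map′ (λ p → 0 , z≤n , p) (λ { (.0 , z≤n , p) → p }) (P? 0)
any≤? {P} P? (suc n) = map′ widen narrow (any≤? P? n ⊎-dec P? (suc n))
  where
  widen : (∃ λ i → i ≤ n × P i) ⊎ P (suc n) → ∃ λ i → i ≤ suc n × P i
  widen (inj₁ (i , i≤n , p)) = i , m≤n⇒m≤1+n i≤n , p
  widen (inj₂ p)             = suc n , ≤-refl , p
  narrow : (∃ λ i → i ≤ suc n × P i) → (∃ λ i → i ≤ n × P i) ⊎ P (suc n)
  narrow (i , i≤1+n , p) with m≤n⇒m<n∨m≡n i≤1+n
  ... | inj₁ (s≤s i≤n) = inj₁ (i , i≤n , p)
  ... | inj₂ refl      = inj₂ p

Oracles : ℕ → Set
Oracles j = Fin j → Baire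

infix  4 _≐_ _≺_
infixr 3 _∧ᶠ_
infixr 2 _∨ᶠ_

mutual
  data Term (j k : ℕ) : Set where
    var  : Fin k → Term j k
    lit  : ℕ → Term j k
    ora  : Fin j → Term j k → Term j k
    _⊕_  : Term j k → Term j k → Term j k
    pair : Term j k → Term j k → Term j k
    ite  : Form j k → Term j k → Term j k → Term j k
    rec  : Term j k → Term j (suc (suc k)) → Term j k → Term j k

  data Form (j k : ℕ) : Set where
    _≐_ _≺_   : Term j k → Term j k → Form j k
    _∧ᶠ_ _∨ᶠ_ : Form j k → Form j k → Form j k
    ¬ᶠ_       : Form j k → Form j k
    ∃≤        : Term j k → Form j (suc k) → Form j k

mutual
  ⟦_⟧ : ∀ {j k} → Term j k → Oracles j → Vec ℕ k → ℕ
  ⟦ var i ⟧     O ρ = lookup ρ i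
  ⟦ lit n ⟧     O ρ = n
  ⟦ ora i t ⟧   O ρ = O i (⟦ t ⟧ O ρ)
  ⟦ t ⊕ u ⟧     O ρ = ⟦ t ⟧ O ρ + ⟦ u ⟧ O ρ
  ⟦ pair t u ⟧  O ρ = pairℕ (⟦ t ⟧ O ρ) (⟦ u ⟧ O ρ)
  ⟦ ite φ t u ⟧ O ρ = if does (sat? φ O ρ) then ⟦ t ⟧ O ρ else ⟦ u ⟧ O ρ
  ⟦ rec z s t ⟧ O ρ = natrec (⟦ z ⟧ O ρ) (λ m r → ⟦ s ⟧ O (m ∷ r ∷ ρ)) (⟦ t ⟧ O ρ)

  Sat : ∀ {j k} → Form j k → Oracles j → Vec ℕ k → Set
  Sat (t ≐ u)  O ρ = ⟦ t ⟧ O ρ ≡ ⟦ u ⟧ O ρ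
  Sat (t ≺ u)  O ρ = ⟦ t ⟧ O ρ < ⟦ u ⟧ O ρ
  Sat (φ ∧ᶠ ψ) O ρ = Sat φ O ρ × Sat ψ O ρ
  Sat (φ ∨ᶠ ψ) O ρ = Sat φ O ρ ⊎ Sat ψ O ρ
  Sat (¬ᶠ φ)   O ρ = ¬ Sat φ O ρ
  Sat (∃≤ t φ) O ρ = ∃ λ i → i ≤ ⟦ t ⟧ O ρ × Sat φ O (i ∷ ρ)

  sat? : ∀ {j k} (φ : Form j k) O ρ → Dec (Sat φ O ρ)
  sat? (t ≐ u)  O ρ = ⟦ t ⟧ O ρ ≟ ⟦ u ⟧ O ρ
  sat? (t ≺ u)  O ρ = ⟦ t ⟧ O ρ <? ⟦ u ⟧ O ρ
  sat? (φ ∧ᶠ ψ) O ρ = sat? φ O ρ ×-dec sat? ψ O ρ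
  sat? (φ ∨ᶠ ψ) O ρ = sat? φ O ρ ⊎-dec sat? ψ O ρ
  sat? (¬ᶠ φ)   O ρ = ¬? (sat? φ O ρ)
  sat? (∃≤ t φ) O ρ = any≤? (λ i → sat? φ O (i ∷ ρ)) (⟦ t ⟧ O ρ)

bit : Bool → ℕ
bit true  = 1
bit false = 0

χ : ∀ {j k} → Form j k → Oracles j → Vec ℕ k → ℕ
χ φ O ρ = bit (does (sat? φ O ρ))

χ≤1 : ∀ {j k} (φ : Form j k) O ρ → χ φ O ρ ≤ 1
χ≤1 φ O ρ with does (sat? φ O ρ)
... | true  = ≤-refl
... | false = z≤n

χ-sound : ∀ {j k} (φ : Form j k) O ρ → χ φ O ρ ≡ 1 → Sat φ O ρ
χ-sound φ O ρ e with sat? φ O ρ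
... | yes s = s
... | no _ with () ← e

χ-complete : ∀ {j k} (φ : Form j k) O ρ → Sat φ O ρ → χ φ O ρ ≡ 1
χ-complete φ O ρ s with sat? φ O ρ
... | yes _ = refl
... | no ¬s = ⊥-elim (¬s s)

χ¬-sound : ∀ {j k} (φ : Form j k) O ρ → χ (¬ᶠ φ) O ρ ≡ 0 → Sat φ O ρ
χ¬-sound φ O ρ e with sat? φ O ρ
... | yes s = s
... | no _ with () ← e

χ¬-complete : ∀ {j k} (φ : Form j k) O ρ → Sat φ O ρ → χ (¬ᶠ φ) O ρ ≡ 0
χ¬-complete φ O ρ s with sat? φ O ρ
... | yes _ = refl
... | no ¬s = ⊥-elim (¬s s)

cond : ℕ → ℕ → ℕ → ℕ
cond zero    a b = b
cond (suc _) a b = a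

constᶜ : ∀ {k} → ℕ → Code k
constᶜ zero    = zer
constᶜ (suc n) = comp succ (constᶜ n ∷ [])

predᶜ : Code 1
predᶜ = prec zer (proj fz)

-- arguments (y ∷ x ∷ []), as `prec` recurses on its first argument
addᶜ monusᶜ : Code 2
addᶜ   = prec (proj fz) (comp succ (proj (fs fz) ∷ []))
monusᶜ = prec (proj fz) (comp predᶜ (proj (fs fz) ∷ []))

condᶜ : Code 3
condᶜ = prec (proj (fs fz)) (proj (fs (fs fz)))

triᶜ : Code 1
triᶜ = prec zer (comp addᶜ (proj (fs fz) ∷ comp succ (proj fz ∷ []) ∷ []))


denote-const : ∀ {k} n f (xs : Vec ℕ k) → denote (constᶜ n) f xs ≡ n
denote-const zero    f xs = refl
denote-const (suc n) f xs = cong suc (denote-const n f xs)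

denote-add : ∀ f y x → denote addᶜ f (y ∷ x ∷ []) ≡ y + x
denote-add f zero    x = refl
denote-add f (suc y) x = cong suc (denote-add f y x)

denote-pred : ∀ f x → denote predᶜ f (x ∷ []) ≡ pred x
denote-pred f zero    = refl
denote-pred f (suc x) = refl

denote-monus : ∀ f y x → denote monusᶜ f (y ∷ x ∷ []) ≡ x ∸ y
denote-monus f zero    x = refl
denote-monus f (suc y) x =
  trans (denote-pred f (denote monusᶜ f (y ∷ x ∷ []))) (trans (cong pred (denote-monus f y x)) (pred[m∸n]≡m∸[1+n] x y))

denote-tri : ∀ f n → denote triᶜ f (n ∷ []) ≡ tri n
denote-tri f zero    = refl
denote-tri f (suc n) = trans (denote-add f _ (suc n)) (cong (_+ suc n) (denote-tri f n))

denote-cond : ∀ f c a b → denote condᶜ f (c ∷ a ∷ b ∷ []) ≡ cond c a b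
denote-cond f zero    a b = refl
denote-cond f (suc c) a b = refl

cond-bit : ∀ b x y → cond (bit b) x y ≡ (if b then x else y)
cond-bit true  x y = refl
cond-bit false x y = refl

eq-bit : ∀ x y → cond ((x ∸ y) + (y ∸ x)) 0 1 ≡ bit (x ≡ᵇ y)
eq-bit zero    zero    = refl
eq-bit zero    (suc y) = refl
eq-bit (suc x) zero    = refl
eq-bit (suc x) (suc y) = eq-bit x y

lt-bit : ∀ x y → cond (y ∸ x) 1 0 ≡ bit (x <ᵇ y)
lt-bit zero    zero    = refl
lt-bit zero    (suc y) = refl
lt-bit (suc x) zero    = refl
lt-bit (suc x) (suc y) = lt-bit x y

ids : ∀ k → Vec (Code k) k
ids k = tabulate proj

drop₂ : ∀ k → Vec (Code (suc (suc k))) k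
drop₂ k = tabulate (λ i → proj (fs (fs i)))

denote-tabulate : ∀ {k n} (h : Fin n → Code k) f ρ → denoteⱽ (tabulate h) f ρ ≡ tabulate (λ i → denote (h i) f ρ)
denote-tabulate {n = zero}  h f ρ = refl
denote-tabulate {n = suc n} h f ρ = cong (denote (h fz) f ρ ∷_) (denote-tabulate (h ∘ fs) f ρ)

denote-ids : ∀ {k} f (ρ : Vec ℕ k) → denoteⱽ (ids k) f ρ ≡ ρ
denote-ids f ρ = trans (denote-tabulate proj f ρ) (tabulate∘lookup ρ)

denote-drop₂ : ∀ {k} f y r (ρ : Vec ℕ k) → denoteⱽ (drop₂ k) f (y ∷ r ∷ ρ) ≡ ρ
denote-drop₂ f y r ρ = trans (denote-tabulate _ f (y ∷ r ∷ ρ)) (tabulate∘lookup ρ)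

-- Compilation of terms and formulas into μ-free codes

-- Oracle i is read from the input f at the address computed by the i-th code of the layout.
Layout : ℕ → Set
Layout j = Fin j → Code 1

view : ∀ {j} → Layout j → Baire → Oracles j
view L f i x = f (denote (L i) f (x ∷ []))

module Compile {j} (L : Layout j) where

  mutual
    compile : ∀ {k} → Term j k → Code k
    compile (var i)     = proj i
    compile (lit n)     = constᶜ n
    compile (ora i t)   = comp orc (comp (L i) (compile t ∷ []) ∷ [])
    compile (t ⊕ u)     = comp addᶜ (compile t ∷ compile u ∷ [])
    compile (pair t u)  = comp addᶜ (comp triᶜ (comp addᶜ (compile t ∷ compile u ∷ []) ∷ []) ∷ compile u ∷ [])
    compile (ite φ t u) = comp condᶜ (compileᶠ φ ∷ compile t ∷ compile u ∷ [])
    compile {k} (rec z s t) = comp (prec (compile z) (compile s)) (compile t ∷ ids k)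

    compileᶠ : ∀ {k} → Form j k → Code k
    compileᶠ (t ≐ u)  = comp condᶜ (comp addᶜ (comp monusᶜ (compile u ∷ compile t ∷ [])
                                       ∷ comp monusᶜ (compile t ∷ compile u ∷ []) ∷ [])
                                   ∷ constᶜ 0 ∷ constᶜ 1 ∷ [])
    compileᶠ (t ≺ u)  = comp condᶜ (comp monusᶜ (compile t ∷ compile u ∷ []) ∷ constᶜ 1 ∷ constᶜ 0 ∷ [])
    compileᶠ (φ ∧ᶠ ψ) = comp condᶜ (compileᶠ φ ∷ compileᶠ ψ ∷ constᶜ 0 ∷ [])
    compileᶠ (φ ∨ᶠ ψ) = comp condᶜ (compileᶠ φ ∷ constᶜ 1 ∷ compileᶠ ψ ∷ [])
    compileᶠ (¬ᶠ φ)   = comp condᶜ (compileᶠ φ ∷ constᶜ 0 ∷ constᶜ 1 ∷ [])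
    compileᶠ {k} (∃≤ t φ) = comp (prec (anyᶜ-base φ) (anyᶜ-step φ)) (compile t ∷ ids k)

    anyᶜ-base : ∀ {k} → Form j (suc k) → Code k
    anyᶜ-base {k} φ = comp (compileᶠ φ) (zer ∷ ids k)

    anyᶜ-step : ∀ {k} → Form j (suc k) → Code (suc (suc k))
    anyᶜ-step {k} φ = comp condᶜ (proj (fs fz) ∷ constᶜ 1 ∷ comp (compileᶠ φ) (comp succ (proj fz ∷ []) ∷ drop₂ k) ∷ [])

  private
    and-bit : ∀ a b → cond (bit a) (bit b) 0 ≡ bit (a ∧ b)
    and-bit true  b = refl
    and-bit false b = refl

    or-bit : ∀ a b → cond (bit a) 1 (bit b) ≡ bit (a ∨ b)
    or-bit true  b = refl
    or-bit false b = refl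

    not-bit : ∀ a → cond (bit a) 0 1 ≡ bit (not a)
    not-bit true  = refl
    not-bit false = refl

  module _ (f : Baire) where
    private
      O : Oracles j
      O = view L f

    mutual
      compile-correct : ∀ {k} (t : Term j k) ρ → denote (compile t) f ρ ≡ ⟦ t ⟧ O ρ
      compile-correct (var i) ρ = refl
      compile-correct (lit n) ρ = denote-const n f ρ
      compile-correct (ora i t) ρ = cong (λ x → f (denote (L i) f (x ∷ []))) (compile-correct t ρ)
      compile-correct (t ⊕ u) ρ rewrite compile-correct t ρ | compile-correct u ρ = denote-add f (⟦ t ⟧ O ρ) (⟦ u ⟧ O ρ)
      compile-correct (pair t u) ρ
        rewrite compile-correct t ρ | compile-correct u ρ
              | denote-add f (⟦ t ⟧ O ρ) (⟦ u ⟧ O ρ) | denote-tri f (⟦ t ⟧ O ρ + ⟦ u ⟧ O ρ) =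
        denote-add f (tri (⟦ t ⟧ O ρ + ⟦ u ⟧ O ρ)) (⟦ u ⟧ O ρ)
      compile-correct (ite φ t u) ρ rewrite compileᶠ-correct φ ρ | compile-correct t ρ | compile-correct u ρ =
        trans (denote-cond f (χ φ O ρ) (⟦ t ⟧ O ρ) (⟦ u ⟧ O ρ)) (cond-bit (does (sat? φ O ρ)) (⟦ t ⟧ O ρ) (⟦ u ⟧ O ρ))
      compile-correct (rec z s t) ρ rewrite compile-correct t ρ | denote-ids f ρ = rec-correct z s (⟦ t ⟧ O ρ) ρ

      rec-correct : ∀ {k} (z : Term j k) s n ρ →
        denoteRec (compile z) (compile s) f n ρ ≡ natrec (⟦ z ⟧ O ρ) (λ m r → ⟦ s ⟧ O (m ∷ r ∷ ρ)) n
      rec-correct z s zero    ρ = compile-correct z ρ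
      rec-correct z s (suc n) ρ
        rewrite compile-correct s (n ∷ denoteRec (compile z) (compile s) f n ρ ∷ ρ) | rec-correct z s n ρ = refl

      compileᶠ-correct : ∀ {k} (φ : Form j k) ρ → denote (compileᶠ φ) f ρ ≡ χ φ O ρ
      compileᶠ-correct (t ≐ u) ρ
        rewrite compile-correct t ρ | compile-correct u ρ | denote-monus f (⟦ u ⟧ O ρ) (⟦ t ⟧ O ρ)
              | denote-monus f (⟦ t ⟧ O ρ) (⟦ u ⟧ O ρ) | denote-add f (⟦ t ⟧ O ρ ∸ ⟦ u ⟧ O ρ) (⟦ u ⟧ O ρ ∸ ⟦ t ⟧ O ρ) =
        trans (denote-cond f _ 0 1) (eq-bit (⟦ t ⟧ O ρ) (⟦ u ⟧ O ρ))
      compileᶠ-correct (t ≺ u) ρ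
        rewrite compile-correct t ρ | compile-correct u ρ | denote-monus f (⟦ t ⟧ O ρ) (⟦ u ⟧ O ρ) =
        trans (denote-cond f _ 1 0) (lt-bit (⟦ t ⟧ O ρ) (⟦ u ⟧ O ρ))
      compileᶠ-correct (φ ∧ᶠ ψ) ρ rewrite compileᶠ-correct φ ρ | compileᶠ-correct ψ ρ =
        trans (denote-cond f (χ φ O ρ) (χ ψ O ρ) 0) (and-bit (does (sat? φ O ρ)) (does (sat? ψ O ρ)))
      compileᶠ-correct (φ ∨ᶠ ψ) ρ rewrite compileᶠ-correct φ ρ | compileᶠ-correct ψ ρ =
        trans (denote-cond f (χ φ O ρ) 1 (χ ψ O ρ)) (or-bit (does (sat? φ O ρ)) (does (sat? ψ O ρ)))
      compileᶠ-correct (¬ᶠ φ) ρ rewrite compileᶠ-correct φ ρ =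
        trans (denote-cond f (χ φ O ρ) 0 1) (not-bit (does (sat? φ O ρ)))
      compileᶠ-correct (∃≤ t φ) ρ rewrite compile-correct t ρ | denote-ids f ρ = any-correct φ (⟦ t ⟧ O ρ) ρ

      any-correct : ∀ {k} (φ : Form j (suc k)) n ρ →
        denoteRec (anyᶜ-base φ) (anyᶜ-step φ) f n ρ ≡ χ (∃≤ (lit n) φ) O ρ
      any-correct φ zero ρ rewrite denote-ids f ρ = compileᶠ-correct φ (0 ∷ ρ)
      any-correct φ (suc n) ρ
        rewrite denote-drop₂ f n (denoteRec (anyᶜ-base φ) (anyᶜ-step φ) f n ρ) ρ
              | compileᶠ-correct φ (suc n ∷ ρ) | any-correct φ n ρ =
        trans (denote-cond f (χ (∃≤ (lit n) φ) O ρ) 1 (χ φ O (suc n ∷ ρ)))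
              (or-bit (does (sat? (∃≤ (lit n) φ) O ρ)) (does (sat? φ O (suc n ∷ ρ))))

  module _ (L-μ-free : ∀ i → T (μ-free (L i))) where
    private
      both : ∀ {a b} → T a → T b → T (a ∧ b)
      both ta tb = Equivalence.from T-∧ (ta , tb)

      const-μ-free : ∀ {k} n → T (μ-free {k} (constᶜ n))
      const-μ-free zero    = tt
      const-μ-free (suc n) = both (const-μ-free n) tt

      tabulate-μ-free : ∀ {k n} (h : Fin n → Code k) → (∀ i → T (μ-free (h i))) → T (μ-freeⱽ (tabulate h))
      tabulate-μ-free {n = zero}  h t = tt
      tabulate-μ-free {n = suc n} h t = both (t fz) (tabulate-μ-free (h ∘ fs) (t ∘ fs))

      ids-μ-free : ∀ k → T (μ-freeⱽ (ids k))
      ids-μ-free k = tabulate-μ-free {k} {k} proj (λ _ → tt)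

      drop₂-μ-free : ∀ k → T (μ-freeⱽ (drop₂ k))
      drop₂-μ-free k = tabulate-μ-free {suc (suc k)} {k} (λ i → proj (fs (fs i))) (λ _ → tt)

    mutual
      compile-μ-free : ∀ {k} (t : Term j k) → T (μ-free (compile t))
      compile-μ-free (var i)     = tt
      compile-μ-free (lit n)     = const-μ-free n
      compile-μ-free (ora i t)   = both (both (L-μ-free i) (both (compile-μ-free t) tt)) tt
      compile-μ-free (t ⊕ u)     = both (compile-μ-free t) (both (compile-μ-free u) tt)
      compile-μ-free (pair t u)  = both (both (both (compile-μ-free t) (both (compile-μ-free u) tt)) tt)
                                       (both (compile-μ-free u) tt)
      compile-μ-free (ite φ t u) = both (compileᶠ-μ-free φ) (both (compile-μ-free t) (both (compile-μ-free u) tt))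
      compile-μ-free {k} (rec z s t) =
        both (both (compile-μ-free z) (compile-μ-free s)) (both (compile-μ-free t) (ids-μ-free k))

      compileᶠ-μ-free : ∀ {k} (φ : Form j k) → T (μ-free (compileᶠ φ))
      compileᶠ-μ-free (t ≐ u)  = both (both (both (compile-μ-free u) (both (compile-μ-free t) tt))
                                         (both (both (compile-μ-free t) (both (compile-μ-free u) tt)) tt)) tt
      compileᶠ-μ-free (t ≺ u)  = both (both (compile-μ-free t) (both (compile-μ-free u) tt)) tt
      compileᶠ-μ-free (φ ∧ᶠ ψ) = both (compileᶠ-μ-free φ) (both (compileᶠ-μ-free ψ) tt)
      compileᶠ-μ-free (φ ∨ᶠ ψ) = both (compileᶠ-μ-free φ) (both (compileᶠ-μ-free ψ) tt)
      compileᶠ-μ-free (¬ᶠ φ)   = both (compileᶠ-μ-free φ) tt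
      compileᶠ-μ-free {k} (∃≤ t φ) =
        both (both (both (compileᶠ-μ-free φ) (ids-μ-free k))
                 (both (both (compileᶠ-μ-free φ) (drop₂-μ-free k)) tt))
            (both (compile-μ-free t) (ids-μ-free k))

    compileᶠ-converges : ∀ {k} (φ : Form j k) f ρ → Converges f (compileᶠ φ) ρ (χ φ (view L f) ρ)
    compileᶠ-converges φ f ρ =
      subst (Converges f (compileᶠ φ) ρ) (compileᶠ-correct f φ ρ) (μ-free⇒converges f _ (compileᶠ-μ-free φ) ρ)

    characteristic : (φ : Form j 1) → ∀ f → compileᶠ φ ⟦ f ⟧≡ (λ n → χ φ (view L f) (n ∷ []))
    characteristic φ f n = compileᶠ-converges φ f (n ∷ [])

    -- unbounded search for a witness of φ, found as the first zero of the bit of ¬ φ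
    witness : ∀ {k} (φ : Form j (suc k)) f ρ i₀ → Sat φ (view L f) (i₀ ∷ ρ) →
      ∃ λ m → Converges f (mu (compileᶠ (¬ᶠ φ))) ρ m × Sat φ (view L f) (m ∷ ρ)
    witness φ f ρ i₀ s with mu-converges f (compileᶠ (¬ᶠ φ)) (compileᶠ-μ-free (¬ᶠ φ)) ρ i₀
                              (trans (compileᶠ-correct f (¬ᶠ φ) (i₀ ∷ ρ)) (χ¬-complete φ (view L f) (i₀ ∷ ρ) s))
    ... | m , conv , zero-m =
      m , conv , χ¬-sound φ (view L f) (m ∷ ρ) (trans (sym (compileᶠ-correct f (¬ᶠ φ) (m ∷ ρ))) zero-m)

_≈ᴼ_ : ∀ {j} → Oracles j → Oracles j → Set
O ≈ᴼ O′ = ∀ i x → O i x ≡ O′ i x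

≈ᴼ-sym : ∀ {j} {O O′ : Oracles j} → O ≈ᴼ O′ → O′ ≈ᴼ O
≈ᴼ-sym e i x = sym (e i x)

mutual
  ⟦⟧-cong : ∀ {j k} {O O′ : Oracles j} → O ≈ᴼ O′ → (t : Term j k) → ∀ ρ → ⟦ t ⟧ O ρ ≡ ⟦ t ⟧ O′ ρ
  ⟦⟧-cong e (var i)     ρ = refl
  ⟦⟧-cong e (lit n)     ρ = refl
  ⟦⟧-cong {O′ = O′} e (ora i t) ρ = trans (e i _) (cong (O′ i) (⟦⟧-cong e t ρ))
  ⟦⟧-cong e (t ⊕ u)     ρ = cong₂ _+_ (⟦⟧-cong e t ρ) (⟦⟧-cong e u ρ)
  ⟦⟧-cong e (pair t u)  ρ = cong₂ pairℕ (⟦⟧-cong e t ρ) (⟦⟧-cong e u ρ)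
  ⟦⟧-cong e (ite φ t u) ρ rewrite does-cong e φ ρ | ⟦⟧-cong e t ρ | ⟦⟧-cong e u ρ = refl
  ⟦⟧-cong {O = O} {O′} e (rec z s t) ρ rewrite ⟦⟧-cong e z ρ | ⟦⟧-cong e t ρ = natrec-cong (⟦ z ⟧ O′ ρ) (⟦ t ⟧ O′ ρ)
    where
    natrec-cong : ∀ z n → natrec z (λ m r → ⟦ s ⟧ O (m ∷ r ∷ ρ)) n ≡ natrec z (λ m r → ⟦ s ⟧ O′ (m ∷ r ∷ ρ)) n
    natrec-cong z zero    = refl
    natrec-cong z (suc n) rewrite natrec-cong z n = ⟦⟧-cong e s _

  Sat-cong : ∀ {j k} {O O′ : Oracles j} → O ≈ᴼ O′ → (φ : Form j k) → ∀ ρ → Sat φ O ρ → Sat φ O′ ρ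
  Sat-cong e (t ≐ u)  ρ s = trans (sym (⟦⟧-cong e t ρ)) (trans s (⟦⟧-cong e u ρ))
  Sat-cong e (t ≺ u)  ρ s = subst₂ _<_ (⟦⟧-cong e t ρ) (⟦⟧-cong e u ρ) s
  Sat-cong e (φ ∧ᶠ ψ) ρ (s , s′) = Sat-cong e φ ρ s , Sat-cong e ψ ρ s′
  Sat-cong e (φ ∨ᶠ ψ) ρ (inj₁ s) = inj₁ (Sat-cong e φ ρ s)
  Sat-cong e (φ ∨ᶠ ψ) ρ (inj₂ s) = inj₂ (Sat-cong e ψ ρ s)
  Sat-cong e (¬ᶠ φ)   ρ ¬s s = ¬s (Sat-cong (≈ᴼ-sym e) φ ρ s)
  Sat-cong e (∃≤ t φ) ρ (i , i≤t , s) = i , subst (i ≤_) (⟦⟧-cong e t ρ) i≤t , Sat-cong e φ (i ∷ ρ) s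

  does-cong : ∀ {j k} {O O′ : Oracles j} → O ≈ᴼ O′ → (φ : Form j k) → ∀ ρ → does (sat? φ O ρ) ≡ does (sat? φ O′ ρ)
  does-cong {O = O} {O′} e φ ρ with sat? φ O ρ | sat? φ O′ ρ
  ... | yes _ | yes _ = refl
  ... | no  _ | no  _ = refl
  ... | yes s | no ¬s = ⊥-elim (¬s (Sat-cong e φ ρ s))
  ... | no ¬s | yes s = ⊥-elim (¬s (Sat-cong (≈ᴼ-sym e) φ ρ s))

-- The three oracles of the reductions: the colouring p, the set q solving the graph problem, the LPO answers r
oracles : Baire → Baire → Baire → Oracles 3
oracles p q r fz           = p
oracles p q r (fs fz)      = q
oracles p q r (fs (fs fz)) = r

doubleᶜ : Code 1
doubleᶜ = comp addᶜ (proj fz ∷ proj fz ∷ [])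

-- Φ reads p, Θ reads ⟨ p , q ⟩ and Ψ reads ⟨ ⟨ p , q ⟩ , r ⟩.
directLayout pairLayout tripleLayout : Layout 3
directLayout _ = proj fz
pairLayout fz           = doubleᶜ
pairLayout (fs fz)      = comp succ (doubleᶜ ∷ [])
pairLayout (fs (fs fz)) = doubleᶜ
tripleLayout fz           = comp doubleᶜ (doubleᶜ ∷ [])
tripleLayout (fs fz)      = comp doubleᶜ (comp succ (doubleᶜ ∷ []) ∷ [])
tripleLayout (fs (fs fz)) = comp succ (doubleᶜ ∷ [])

directLayout-μ-free : ∀ i → T (μ-free (directLayout i))
directLayout-μ-free _ = tt

pairLayout-μ-free : ∀ i → T (μ-free (pairLayout i))
pairLayout-μ-free fz           = tt
pairLayout-μ-free (fs fz)      = tt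
pairLayout-μ-free (fs (fs fz)) = tt

tripleLayout-μ-free : ∀ i → T (μ-free (tripleLayout i))
tripleLayout-μ-free fz           = tt
tripleLayout-μ-free (fs fz)      = tt
tripleLayout-μ-free (fs (fs fz)) = tt

interleave-even : ∀ f g x → ⟨ f , g ⟩ (x + x) ≡ f x
interleave-even f g zero    = refl
interleave-even f g (suc x) rewrite +-suc x x = interleave-even (f ∘ suc) (g ∘ suc) x

interleave-odd : ∀ f g x → ⟨ f , g ⟩ (suc (x + x)) ≡ g x
interleave-odd f g zero    = refl
interleave-odd f g (suc x) rewrite +-suc x x = interleave-odd (f ∘ suc) (g ∘ suc) x

denote-double : ∀ f x → denote doubleᶜ f (x ∷ []) ≡ x + x
denote-double f x = denote-add f x x

view-pair : ∀ p q → view pairLayout ⟨ p , q ⟩ ≈ᴼ oracles p q p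
view-pair p q fz x rewrite denote-double ⟨ p , q ⟩ x = interleave-even p q x
view-pair p q (fs fz) x rewrite denote-double ⟨ p , q ⟩ x = interleave-odd p q x
view-pair p q (fs (fs fz)) x rewrite denote-double ⟨ p , q ⟩ x = interleave-even p q x

view-triple : ∀ p q r → view tripleLayout ⟨ ⟨ p , q ⟩ , r ⟩ ≈ᴼ oracles p q r
view-triple p q r fz x
  rewrite denote-double ⟨ ⟨ p , q ⟩ , r ⟩ x | denote-double ⟨ ⟨ p , q ⟩ , r ⟩ (x + x)
  = trans (interleave-even ⟨ p , q ⟩ r (x + x)) (interleave-even p q x)
view-triple p q r (fs fz) x
  rewrite denote-double ⟨ ⟨ p , q ⟩ , r ⟩ x | denote-double ⟨ ⟨ p , q ⟩ , r ⟩ (suc (x + x))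
  = trans (interleave-even ⟨ p , q ⟩ r (suc (x + x))) (interleave-odd p q x)
view-triple p q r (fs (fs fz)) x rewrite denote-double ⟨ ⟨ p , q ⟩ , r ⟩ x = interleave-odd ⟨ p , q ⟩ r x

tri-mono : ∀ {m n} → m ≤ n → tri m ≤ tri n
tri-mono {m} m≤n = mono-by-step {λ n → tri m ≤ tri n} (λ n le → ≤-trans le (m≤m+n (tri n) (suc n))) m≤n ≤-refl

n≤tri : ∀ n → n ≤ tri n
n≤tri zero    = z≤n
n≤tri (suc n) = subst (suc n ≤_) (+-comm (suc n) (tri n)) (m≤m+n (suc n) (tri n))

pairℕ-<-mono : ∀ a b c d → a + b < c + d → pairℕ a b < pairℕ c d
pairℕ-<-mono a b c d lt = begin-strict
  tri (a + b) + b         ≤⟨ +-monoʳ-≤ (tri (a + b)) (m≤n+m b a) ⟩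
  tri (a + b) + (a + b)   <⟨ +-monoʳ-< (tri (a + b)) ≤-refl ⟩
  tri (suc (a + b))       ≤⟨ tri-mono lt ⟩
  tri (c + d)             ≤⟨ m≤m+n (tri (c + d)) d ⟩
  tri (c + d) + d         ∎
  where open ≤-Reasoning

pairℕ-injective : ∀ {a b c d} → pairℕ a b ≡ pairℕ c d → a ≡ c × b ≡ d
pairℕ-injective {a} {b} {c} {d} e with <-cmp (a + b) (c + d)
... | tri< lt _ _ = ⊥-elim (<⇒≢ (pairℕ-<-mono a b c d lt) e)
... | tri> _ _ gt = ⊥-elim (<⇒≢ (pairℕ-<-mono c d a b gt) (sym e))
... | tri≈ _ s _  = +-cancelʳ-≡ b a c (trans s (cong (c +_) (sym b≡d))) , b≡d
  where
  b≡d : b ≡ d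
  b≡d = +-cancelˡ-≡ (tri (a + b)) b d (trans e (cong (λ z → tri z + d) (sym s)))

left≤pairℕ : ∀ a b → a ≤ pairℕ a b
left≤pairℕ a b = ≤-trans (m≤m+n a b) (≤-trans (n≤tri (a + b)) (m≤m+n (tri (a + b)) b))

right≤pairℕ : ∀ a b → b ≤ pairℕ a b
right≤pairℕ a b = m≤n+m b (tri (a + b))

Adj : Baire → ℕ → ℕ → Set
Adj p x y = (x < y × col p x y ≡ 1) ⊎ (y < x × col p y x ≡ 1)

Adj-sym : ∀ p {x y} → Adj p x y → Adj p y x
Adj-sym p (inj₁ e) = inj₂ e
Adj-sym p (inj₂ e) = inj₁ e

Adj-irrefl : ∀ p {x} → ¬ Adj p x x
Adj-irrefl p (inj₁ (x<x , _)) = <-irrefl refl x<x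
Adj-irrefl p (inj₂ (x<x , _)) = <-irrefl refl x<x

x₀ : ∀ {j k} → Term j (suc k)
x₀ = var fz
x₁ : ∀ {j k} → Term j (suc (suc k))
x₁ = var (fs fz)
x₂ : ∀ {j k} → Term j (suc (suc (suc k)))
x₂ = var (fs (fs fz))
x₃ : ∀ {j k} → Term j (suc (suc (suc (suc k))))
x₃ = var (fs (fs (fs fz)))
x₄ : ∀ {j k} → Term j (suc (suc (suc (suc (suc k)))))
x₄ = var (fs (fs (fs (fs fz))))
x₅ : ∀ {j k} → Term j (suc (suc (suc (suc (suc (suc k))))))
x₅ = var (fs (fs (fs (fs (fs fz)))))

colouring set answers : Fin 3
colouring = fz
set       = fs fz
answers   = fs (fs fz)

adjᶠ : ∀ {k} → Term 3 k → Term 3 k → Form 3 k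
adjᶠ s t = (s ≺ t ∧ᶠ ora colouring (pair s t) ≐ lit 1) ∨ᶠ (t ≺ s ∧ᶠ ora colouring (pair t s) ≐ lit 1)

inᶠ : ∀ {k} → Term 3 k → Form 3 k
inᶠ t = ora set t ≐ lit 1

-- vertices are coded as ⟨0 , x⟩, edges as ⟨1 , ⟨x , y⟩⟩
graphᶠ : Form 3 1
graphᶠ = ∃≤ x₀ (x₁ ≐ pair (lit 0) x₀) ∨ᶠ ∃≤ x₀ (∃≤ x₁ (x₂ ≐ pair (lit 1) (pair x₁ x₀) ∧ᶠ adjᶠ x₁ x₀))

graph : Baire → Baire
graph p n = χ graphᶠ (view directLayout p) (n ∷ [])

graphᶜ : TuringFunctional
graphᶜ = Compile.compileᶠ directLayout graphᶠ

graph-computable : ∀ p → graphᶜ ⟦ p ⟧≡ graph p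
graph-computable = Compile.characteristic directLayout directLayout-μ-free graphᶠ

module _ (p : Baire) where

  graph-vertex : ∀ x → Vx (graph p) x
  graph-vertex x = χ-complete graphᶠ (view directLayout p) (pairℕ 0 x ∷ []) (inj₁ (x , right≤pairℕ 0 x , refl))

  graph-edge : ∀ {x y} → Ex (graph p) x y → Adj p x y
  graph-edge {x} {y} e with χ-sound graphᶠ (view directLayout p) (pairℕ 1 (pairℕ x y) ∷ []) e
  ... | inj₁ (z , _ , code) with () ← proj₁ (pairℕ-injective {1} {pairℕ x y} {0} {z} code)
  ... | inj₂ (x′ , _ , y′ , _ , code , adj)
    with pairℕ-injective {x} {y} {x′} {y′} (proj₂ (pairℕ-injective {1} {pairℕ x y} {1} {pairℕ x′ y′} code))
  ...   | refl , refl = adj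

  Adj⇒graph-edge : ∀ {x y} → Adj p x y → Ex (graph p) x y
  Adj⇒graph-edge {x} {y} adj =
    χ-complete graphᶠ (view directLayout p) (pairℕ 1 (pairℕ x y) ∷ []) (inj₂ (x , x≤code , y , y≤code , refl , adj))
    where
    x≤code : x ≤ pairℕ 1 (pairℕ x y)
    x≤code = ≤-trans (left≤pairℕ x y) (right≤pairℕ 1 (pairℕ x y))
    y≤code : y ≤ pairℕ 1 (pairℕ x y)
    y≤code = ≤-trans (right≤pairℕ x y) (right≤pairℕ 1 (pairℕ x y))

  graph≤1 : ∀ n → graph p n ≤ 1
  graph≤1 n = χ≤1 graphᶠ (view directLayout p) (n ∷ [])

  graph-infinite : IsInfGraph (graph p)
  graph-infinite = (λ x → graph≤1 (pairℕ 0 x)) , (λ x y → graph≤1 (pairℕ 1 (pairℕ x y)))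
                 , (λ x → Adj-irrefl p ∘ graph-edge {x} {x})
                 , (λ x y → Adj⇒graph-edge {y} {x} ∘ Adj-sym p ∘ graph-edge {x} {y})
                 , (λ x y _ → graph-vertex x , graph-vertex y) , (λ n → n , ≤-refl , graph-vertex n)

Infinite : (ℕ → Set) → Set
Infinite S = ∀ n → ∃ λ m → n ≤ m × S m

Homogeneous : Baire → ℕ → (ℕ → Set) → Set
Homogeneous p i S = ∀ x y → x < y → S x → S y → col p x y ≡ i

colour-zero : ∀ {p x y} → col p x y ≤ 1 → ¬ col p x y ≡ 1 → col p x y ≡ 0
colour-zero {p} {x} {y} ≤1 ≢1 with col p x y
... | zero        = refl
... | suc zero    = ⊥-elim (≢1 refl)
... | suc (suc _) = ⊥-elim (<⇒≱ (s≤s (s≤s z≤n)) ≤1)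

Stable : Baire → Set
Stable p = ∀ x → ∃ λ i → ∃ λ s₀ → ∀ s → s₀ ≤ s → x < s → col p x s ≡ i

LimitOne : Baire → ℕ → Set
LimitOne p x = ∃ λ s₀ → ∀ s → s₀ ≤ s → x < s → col p x s ≡ 1

cofinally-adjacent⇒limit-one : ∀ {p} → Stable p → ∀ x → Infinite (Adj p x) → LimitOne p x
cofinally-adjacent⇒limit-one {p} stable x adjacent with stable x
... | i , s₀ , limit with adjacent (s₀ + suc x)
...   | m , far , inj₂ (m<x , _) = ⊥-elim (<-asym m<x (≤-trans (m≤n+m (suc x) s₀) far))
...   | m , far , inj₁ (x<m , one) =
  s₀ , λ s s₀≤s x<s → trans (limit s s₀≤s x<s) (trans (sym (limit m (≤-trans (m≤m+n s₀ (suc x)) far) x<m)) one)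

eventually-one : ∀ {p} (C : ℕ → Set) → (∀ z → Dec (C z)) → (∀ z → C z → LimitOne p z) →
  ∀ ℓ → ∃ λ B → ∀ z → z ≤ ℓ → C z → ∀ s → B ≤ s → z < s → col p z s ≡ 1
eventually-one {p} C C? limit zero with C? 0
... | yes c = proj₁ (limit 0 c) , λ { .0 z≤n _ → proj₂ (limit 0 c) }
... | no ¬c = 0 , λ { .0 z≤n c → ⊥-elim (¬c c) }
eventually-one {p} C C? limit (suc ℓ) with eventually-one {p} C C? limit ℓ | C? (suc ℓ)
... | B , below | no ¬c = B , at
  where
  at : ∀ z → z ≤ suc ℓ → C z → ∀ s → B ≤ s → z < s → col p z s ≡ 1
  at z z≤1+ℓ c with m≤n⇒m<n∨m≡n z≤1+ℓ
  ... | inj₁ (s≤s z≤ℓ) = below z z≤ℓ c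
  ... | inj₂ refl      = ⊥-elim (¬c c)
... | B , below | yes c with limit (suc ℓ) c
...   | s₀ , top = B ⊔ s₀ , at
  where
  at : ∀ z → z ≤ suc ℓ → C z → ∀ s → B ⊔ s₀ ≤ s → z < s → col p z s ≡ 1
  at z z≤1+ℓ c s B⊔s₀≤s with m≤n⇒m<n∨m≡n z≤1+ℓ
  ... | inj₁ (s≤s z≤ℓ) = below z z≤ℓ c s (≤-trans (m≤m⊔n B s₀) B⊔s₀≤s)
  ... | inj₂ refl      = top s (≤-trans (m≤n⊔m B s₀) B⊔s₀≤s)

if-yes : ∀ {A : Set} {x y : ℕ} (d : Dec A) → A → (if does d then x else y) ≡ x
if-yes (yes _) _ = refl
if-yes (no ¬a) a = ⊥-elim (¬a a)

if-no : ∀ {A : Set} {x y : ℕ} (d : Dec A) → ¬ A → (if does d then x else y) ≡ y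
if-no (yes a) ¬a = ⊥-elim (¬a a)
if-no (no _)  _  = refl

-- The greedy 1-homogeneous set above an edge a < b of q

succᵗ : ∀ {j k} → Term j k → Term j k
succᵗ t = lit 1 ⊕ t

candidateᶠ : ∀ {k} → Term 3 k → Term 3 k → Term 3 k → Form 3 k
candidateᶠ a b z = inᶠ z ∧ᶠ (z ≐ a ∨ᶠ adjᶠ z a) ∧ᶠ (z ≐ b ∨ᶠ adjᶠ z b)

-- in the context m ∷ ℓ ∷ n ∷ a ∷ b ∷ _: may m + 1 follow the last chosen point ℓ?
extendsᶠ : ∀ {k} → Form 3 (5 + k)
extendsᶠ = x₄ ≺ succᵗ x₀ ∧ᶠ inᶠ (succᵗ x₀) ∧ᶠ ¬ᶠ ∃≤ x₁ (candidateᶠ x₄ x₅ x₀ ∧ᶠ ¬ᶠ adjᶠ x₀ (succᵗ x₁))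

-- in the context n ∷ a ∷ b ∷ _: the last point chosen up to n
lastᵗ : ∀ {k} → Term 3 (3 + k)
lastᵗ = rec x₂ (ite extendsᶠ (succᵗ x₀) x₁) x₀

greedyᶠ : ∀ {k} → Form 3 (3 + k)
greedyᶠ = ¬ᶠ (x₀ ≺ x₂) ∧ᶠ lastᵗ ≐ x₀

module Greedy (p q r : Baire) {k} (ρ : Vec ℕ k) (a b : ℕ) where

  private
    O : Oracles 3
    O = oracles p q r

  Candidate : ℕ → Set
  Candidate z = q z ≡ 1 × (z ≡ a ⊎ Adj p z a) × (z ≡ b ⊎ Adj p z b)

  Extends : ℕ → ℕ → Set
  Extends m ℓ = b < suc m × q (suc m) ≡ 1 × ¬ (∃ λ z → z ≤ ℓ × Candidate z × ¬ Adj p z (suc m))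

  -- n occupies the context of extendsᶠ without occurring in it
  extends? : ∀ m ℓ → Dec (Extends m ℓ)
  extends? m ℓ = sat? extendsᶠ O (m ∷ ℓ ∷ 0 ∷ a ∷ b ∷ ρ)

  last : ℕ → ℕ
  last n = ⟦ lastᵗ ⟧ O (n ∷ a ∷ b ∷ ρ)

  last-suc : ∀ n → last (suc n) ≡ (if does (extends? n (last n)) then suc n else last n)
  last-suc n = refl

  adj? : ∀ x y → Dec (Adj p x y)
  adj? x y = sat? (adjᶠ x₀ x₁) O (x ∷ y ∷ [])

  candidate? : ∀ z → Dec (Candidate z)
  candidate? z = sat? (candidateᶠ x₁ x₂ x₀) O (z ∷ a ∷ b ∷ [])

  Chosen : ℕ → Set
  Chosen n = Sat greedyᶠ O (n ∷ a ∷ b ∷ ρ)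

  last-extends : ∀ {n} → Extends n (last n) → last (suc n) ≡ suc n
  last-extends {n} e = trans (last-suc n) (if-yes (extends? n (last n)) e)

  last-stays : ∀ {n} → ¬ Extends n (last n) → last (suc n) ≡ last n
  last-stays {n} ¬e = trans (last-suc n) (if-no (extends? n (last n)) ¬e)

  extends⇒adjacent : ∀ {m ℓ} → Extends m ℓ → ∀ z → z ≤ ℓ → Candidate z → Adj p z (suc m)
  extends⇒adjacent {m} (_ , _ , no-gap) z z≤ℓ c with adj? z (suc m)
  ... | yes adj = adj
  ... | no ¬adj = ⊥-elim (no-gap (z , z≤ℓ , c , ¬adj))

  module _ (a<b : a < b) (qa : q a ≡ 1) (qb : q b ≡ 1) (ab : Adj p a b)
           (q-infinite : InfiniteS q) (limit : ∀ z → Candidate z → LimitOne p z) where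

    last-invariant : ∀ n → Candidate (last n) × b ≤ last n × last n ≤ b ⊔ n
    last-invariant zero = (qb , inj₂ (Adj-sym p ab) , inj₁ refl) , ≤-refl , m≤m⊔n b 0
    last-invariant (suc n) with last-invariant n | extends? n (last n)
    ... | c , b≤ , ≤b⊔n | no ¬e rewrite last-stays ¬e = c , b≤ , ≤-trans ≤b⊔n (⊔-monoʳ-≤ b (n≤1+n n))
    ... | c , b≤ , _    | yes e@(b<1+n , q1+n , _) rewrite last-extends e =
      (q1+n , inj₂ (Adj-sym p (towards (<⇒≤ a<b) (qa , inj₁ refl , inj₂ ab)))
            , inj₂ (Adj-sym p (towards ≤-refl (qb , inj₂ (Adj-sym p ab) , inj₁ refl))))
      , <⇒≤ b<1+n , m≤n⊔m b (suc n)
      where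
      towards : ∀ {z} → z ≤ b → Candidate z → Adj p z (suc n)
      towards z≤b = extends⇒adjacent e _ (≤-trans z≤b b≤)

    last≤ : ∀ {n} → b ≤ n → last n ≤ n
    last≤ {n} b≤n = ≤-trans (proj₂ (proj₂ (last-invariant n))) (≤-reflexive (m≤n⇒m⊔n≡n b≤n))

    last-mono : ∀ {m n} → m ≤ n → last m ≤ last n
    last-mono {m} m≤n = mono-by-step {λ n → last m ≤ last n} step m≤n ≤-refl
      where
      step : ∀ n → last m ≤ last n → last m ≤ last (suc n)
      step n le with extends? n (last n)
      ... | yes e@(b<1+n , _) rewrite last-extends e = ≤-trans le (≤-trans (last≤ (≤-pred b<1+n)) (n≤1+n n))
      ... | no ¬e             rewrite last-stays ¬e  = le

    chosen-homogeneous : Homogeneous p 1 Chosen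
    chosen-homogeneous x (suc y) (s≤s x≤y) (x≮b , last-x) (_ , last-y) with extends? y (last y)
    ... | no ¬e = ⊥-elim (1+n≰n (subst (_≤ y) (trans (sym (last-stays ¬e)) last-y) (last≤ (≤-trans (≮⇒≥ x≮b) x≤y))))
    ... | yes e with extends⇒adjacent e x (subst (_≤ last y) last-x (last-mono x≤y))
                                          (subst Candidate last-x (proj₁ (last-invariant x)))
    ...   | inj₁ (_ , one)  = one
    ...   | inj₂ (y<x , _) = ⊥-elim (<-asym (s≤s x≤y) y<x)

    last-settles-or-chosen : ∀ N d → last (d + N) ≡ last N ⊎ ∃ λ m → N < m × last m ≡ m
    last-settles-or-chosen N zero = inj₁ refl
    last-settles-or-chosen N (suc d) with last-settles-or-chosen N d
    ... | inj₂ found = inj₂ found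
    ... | inj₁ same with extends? (d + N) (last (d + N))
    ...   | yes e = inj₂ (suc (d + N) , s≤s (m≤n+m N d) , last-extends e)
    ...   | no ¬e = inj₁ (trans (last-stays ¬e) same)

    -- If nothing is chosen after N, the first point y + 1 of q beyond N that is joined with colour 1
    -- to every candidate up to last N is.
    chosen-beyond : ∀ N → b ≤ N → ∃ λ m → N ≤ m × Chosen m
    chosen-beyond N b≤N with eventually-one {p} Candidate candidate? limit (last N)
    ... | B , one-beyond with q-infinite (suc (B ⊔ N))
    ...   | suc y , s≤s B⊔N≤y , qy with last-settles-or-chosen N (y ∸ N)
    ...     | inj₂ (m , N<m , last-m) = m , <⇒≤ N<m , <⇒≯ (≤-<-trans b≤N N<m) , last-m
    ...     | inj₁ same = suc y , ≤-trans N≤y (n≤1+n y) , <⇒≯ (s≤s (≤-trans b≤N N≤y)) , last-extends extends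
      where
      N≤y : N ≤ y
      N≤y = ≤-trans (m≤n⊔m B N) B⊔N≤y
      last-y : last y ≡ last N
      last-y = subst (λ z → last z ≡ last N) (m∸n+n≡m N≤y) same
      joined : ∀ {z} → z ≤ last y → Candidate z → Adj p z (suc y)
      joined {z} z≤ℓ c = inj₁ (z<1+y , one-beyond z z≤lastN c (suc y) B≤1+y z<1+y)
        where
        z≤lastN = subst (z ≤_) last-y z≤ℓ
        z<1+y = s≤s (≤-trans z≤lastN (≤-trans (last≤ b≤N) N≤y))
        B≤1+y = ≤-trans (m≤m⊔n B N) (≤-trans B⊔N≤y (n≤1+n y))
      extends : Extends y (last y)
      extends = s≤s (≤-trans b≤N N≤y) , qy , λ { (z , z≤ℓ , c , ¬adj) → ¬adj (joined z≤ℓ c) }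

    chosen-infinite : Infinite Chosen
    chosen-infinite N with chosen-beyond (N ⊔ b) (m≤n⊔m N b)
    ... | m , N⊔b≤m , c = m , ≤-trans (m≤m⊔n N b) N⊔b≤m , c

-- The greedy independent set of q ∖ {v}, where every point has at most one neighbour

-- in the context n ∷ a ∷ b ∷ v ∷ _: n ∈ q ∖ {v} has no smaller neighbour in q ∖ {v}
independentᶠ : ∀ {k} → Form 3 (4 + k)
independentᶠ = inᶠ x₀ ∧ᶠ ¬ᶠ (x₀ ≐ x₃) ∧ᶠ ¬ᶠ ∃≤ x₀ (x₀ ≺ x₁ ∧ᶠ inᶠ x₀ ∧ᶠ ¬ᶠ (x₀ ≐ x₄) ∧ᶠ adjᶠ x₀ x₁)

either-or-all : ∀ {A : Set} {n} {Q : Fin n → Set} → (∀ i → A ⊎ Q i) → A ⊎ (∀ i → Q i)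
either-or-all {n = zero}  choice = inj₂ (λ ())
either-or-all {n = suc n} choice with choice fz | either-or-all (choice ∘ fs)
... | inj₁ a | _      = inj₁ a
... | inj₂ _ | inj₁ a = inj₁ a
... | inj₂ q | inj₂ qs = inj₂ λ { fz → q ; (fs i) → qs i }

module Independent (p q r : Baire) (v : ℕ) where

  private
    O : Oracles 3
    O = oracles p q r

  Rest : ℕ → Set
  Rest z = q z ≡ 1 × ¬ z ≡ v

  HasLowerNeighbour : ℕ → Set
  HasLowerNeighbour n = ∃ λ m → m ≤ n × m < n × q m ≡ 1 × ¬ m ≡ v × Adj p m n

  Independent : ℕ → Set
  Independent n = q n ≡ 1 × ¬ n ≡ v × ¬ HasLowerNeighbour n

  -- a and b occupy the context of independentᶠ without occurring in it
  independent? : ∀ n → Dec (Independent n)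
  independent? n = sat? independentᶠ O (n ∷ 0 ∷ 0 ∷ v ∷ [])

  lower-neighbour? : ∀ n → Dec (HasLowerNeighbour n)
  lower-neighbour? n = sat? (∃≤ x₀ (x₀ ≺ x₁ ∧ᶠ inᶠ x₀ ∧ᶠ ¬ᶠ (x₀ ≐ x₄) ∧ᶠ adjᶠ x₀ x₁)) O (n ∷ 0 ∷ 0 ∷ v ∷ [])

  independent-homogeneous : (∀ x y → x < y → col p x y ≤ 1) → Homogeneous p 0 Independent
  independent-homogeneous ≤1 x y x<y (qx , x≢v , _) (_ , _ , no-lower) =
    colour-zero {p} {x} {y} (≤1 x y x<y) λ one → no-lower (x , <⇒≤ x<y , x<y , qx , x≢v , inj₁ (x<y , one))

  module _ (q-infinite : InfiniteS q)
           (one-neighbour : ∀ u → Rest u → ∀ c d → Rest c → Rest d → Adj p u c → Adj p u d → c ≡ d) where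

    lower-neighbour-independent : ∀ {m e} → Rest m → Rest e → m < e → Adj p m e → Independent m
    lower-neighbour-independent (qm , m≢v) re m<e adj =
      qm , m≢v , λ { (m′ , _ , m′<m , qm′ , m′≢v , adj′) →
        <-irrefl (one-neighbour _ (qm , m≢v) m′ _ (qm′ , m′≢v) re (Adj-sym p adj′) adj) (<-trans m′<m m<e) }

    rest-beyond : ∀ n → ∃ λ m → n ≤ m × Rest m
    rest-beyond n with q-infinite (n ⊔ suc v)
    ... | m , le , qm = m , ≤-trans (m≤m⊔n n (suc v)) le , qm , λ { refl → 1+n≰n (≤-trans (m≤n⊔m n (suc v)) le) }

    enumerate : ℕ → ℕ → ℕ
    enumerate N zero    = proj₁ (rest-beyond N)
    enumerate N (suc i) = proj₁ (rest-beyond (suc (enumerate N i)))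

    enumerate-rest : ∀ N i → Rest (enumerate N i)
    enumerate-rest N zero    = proj₂ (proj₂ (rest-beyond N))
    enumerate-rest N (suc i) = proj₂ (proj₂ (rest-beyond (suc (enumerate N i))))

    enumerate-≥ : ∀ N i → N ≤ enumerate N i
    enumerate-≥ N zero    = proj₁ (proj₂ (rest-beyond N))
    enumerate-≥ N (suc i) = ≤-trans (enumerate-≥ N i) (≤-trans (n≤1+n _) (proj₁ (proj₂ (rest-beyond (suc (enumerate N i))))))

    enumerate-<-mono : ∀ N {i j} → i < j → enumerate N i < enumerate N j
    enumerate-<-mono N {i} {suc j} (s≤s i≤j) with m≤n⇒m<n∨m≡n i≤j
    ... | inj₁ i<j = <-trans (enumerate-<-mono N i<j) (proj₁ (proj₂ (rest-beyond (suc (enumerate N j)))))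
    ... | inj₂ refl = proj₁ (proj₂ (rest-beyond (suc (enumerate N i))))

    Found : ℕ → Set
    Found N = ∃ λ m → N ≤ m × Independent m

    LowNeighbour : ℕ → ℕ → Set
    LowNeighbour N e = ∃ λ m → m < N × Rest m × Adj p m e

    probe : ∀ N i → Found N ⊎ LowNeighbour N (enumerate N i)
    probe N i with independent? (enumerate N i) | lower-neighbour? (enumerate N i)
    ... | yes ind | _      = inj₁ (enumerate N i , enumerate-≥ N i , ind)
    ... | no ¬ind | no ¬lower = ⊥-elim (¬ind (proj₁ (enumerate-rest N i) , proj₂ (enumerate-rest N i) , ¬lower))
    ... | no _    | yes (m , _ , m<e , qm , m≢v , adj) with N ≤? m
    ...   | yes N≤m = inj₁ (m , N≤m , lower-neighbour-independent (qm , m≢v) (enumerate-rest N i) m<e adj)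
    ...   | no N≰m  = inj₂ (m , ≰⇒> N≰m , (qm , m≢v) , adj)

    -- N + 1 points of q ∖ {v} cannot all have their lower neighbour among the N points below N.
    independent-infinite : Infinite Independent
    independent-infinite N with either-or-all (probe N ∘ toℕ {suc N})
    ... | inj₁ found = found
    ... | inj₂ low with pigeonhole (n<1+n N) (λ i → fromℕ< (proj₁ (proj₂ (low i))))
    ...   | i , j , i<j , same = ⊥-elim (<-irrefl eᵢ≡eⱼ (enumerate-<-mono N i<j))
      where
      eᵢ≡eⱼ : enumerate N (toℕ i) ≡ enumerate N (toℕ j)
      eᵢ≡eⱼ with low i | low j | trans (sym (toℕ-fromℕ< _)) (trans (cong toℕ same) (toℕ-fromℕ< _))
      ... | m , _ , rest-m , adj-i | _ , _ , _ , adj-j | refl =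
        one-neighbour m rest-m _ _ (enumerate-rest N (toℕ i)) (enumerate-rest N (toℕ j)) adj-i adj-j

-- the i-th answer of LPO is "no witness"
gateᶠ : ∀ {k} → ℕ → Form 3 k
gateᶠ i = ora answers (lit i) ≐ lit 1

-- in the context b ∷ a ∷ _: a < b is an edge of q
edgeᶠ : ∀ {k} → Form 3 (2 + k)
edgeᶠ = inᶠ x₁ ∧ᶠ inᶠ x₀ ∧ᶠ x₁ ≺ x₀ ∧ᶠ adjᶠ x₁ x₀

-- in the context d ∷ c ∷ b ∷ a ∷ _: c - a - b - d is a path in q with a < b
pathᶠ : ∀ {k} → Form 3 (4 + k)
pathᶠ = inᶠ x₃ ∧ᶠ inᶠ x₂ ∧ᶠ inᶠ x₁ ∧ᶠ inᶠ x₀ ∧ᶠ x₃ ≺ x₂ ∧ᶠ adjᶠ x₃ x₂ ∧ᶠ adjᶠ x₃ x₁ ∧ᶠ ¬ᶠ (x₁ ≐ x₂)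
      ∧ᶠ adjᶠ x₂ x₀ ∧ᶠ ¬ᶠ (x₀ ≐ x₃)

-- in the context d ∷ c ∷ v ∷ _: v has the two neighbours c ≠ d in q
forkᶠ : ∀ {k} → Form 3 (3 + k)
forkᶠ = inᶠ x₂ ∧ᶠ inᶠ x₁ ∧ᶠ inᶠ x₀ ∧ᶠ ¬ᶠ (x₁ ≐ x₀) ∧ᶠ adjᶠ x₂ x₁ ∧ᶠ adjᶠ x₂ x₀

-- in the context w ∷ _: an edge, path or fork below w
edge≤ᶠ path≤ᶠ fork≤ᶠ : ∀ {k} → Form 3 (suc k)
edge≤ᶠ = ∃≤ x₀ (∃≤ x₁ edgeᶠ)
path≤ᶠ = ∃≤ x₀ (∃≤ x₁ (∃≤ x₂ (∃≤ x₃ pathᶠ)))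
fork≤ᶠ = ∃≤ x₀ (∃≤ x₁ (∃≤ x₂ forkᶠ))

-- in the context n ∷ a ∷ b ∷ v ∷ _: the alternative if LPO found no witness, the greedy set otherwise
outputᶠ : Form 3 4 → Form 3 4
outputᶠ alternative = (gateᶠ 0 ∧ᶠ alternative) ∨ᶠ (¬ᶠ gateᶠ 0 ∧ᶠ greedyᶠ)

srt-solution : ∀ {p h} i (S : ℕ → Set) → (∀ n → h n ≤ 1) → (∀ n → h n ≡ 1 → S n) → (∀ n → S n → h n ≡ 1) →
  Infinite S → Homogeneous p i S → sol SRT22 p h
srt-solution i S ≤1 sound complete infinite homogeneous =
  ≤1 , (λ n → let (m , n≤m , s) = infinite n in m , n≤m , complete m s) ,
  i , λ x y x<y hx hy → homogeneous x y x<y (sound x hx) (sound y hy)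

Answered : ℕ → (ℕ → Set) → Set
Answered s P = (s ≡ 0 × ∃ P) ⊎ (s ≡ 1 × ∀ w → ¬ P w)

lpo-answer : ∀ {j} (φ : Form j 1) O (index : ℕ → ℕ) r → sol LPO (λ w → χ (¬ᶠ φ) O (index w ∷ [])) r →
  Answered (r 0) (λ w → Sat φ O (index w ∷ []))
lpo-answer φ O index r (inj₁ (yes₀ , w , zero-w)) = inj₁ (yes₀ , w , χ¬-sound φ O (index w ∷ []) zero-w)
lpo-answer φ O index r (inj₂ (no₀ , nowhere))   = inj₂ (no₀ , λ w s → nowhere w (χ¬-complete φ O (index w ∷ []) s))

unless-answered : ∀ {s P} → Answered s P → s ≡ 1 ⊎ ∃ P
unless-answered (inj₁ (_ , found))  = inj₂ found
unless-answered (inj₂ (opened , _)) = inj₁ opened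

module Readout (p q r : Baire) where

  f : Baire
  f = ⟨ ⟨ p , q ⟩ , r ⟩

  O : Oracles 3
  O = oracles p q r

  open Compile tripleLayout

  find : ∀ {k} (φ : Form 3 (suc k)) ρ i₀ → Sat φ O (i₀ ∷ ρ) →
    ∃ λ m → Converges f (mu (compileᶠ (¬ᶠ φ))) ρ m × Sat φ O (m ∷ ρ)
  find φ ρ i₀ s with witness tripleLayout-μ-free φ f ρ i₀ (Sat-cong (≈ᴼ-sym (view-triple p q r)) φ _ s)
  ... | m , conv , s′ = m , conv , Sat-cong (view-triple p q r) φ _ s′

  readout-solution : ∀ {k} (φ : Form 3 (suc k)) ρ i (S : ℕ → Set) →
    (∀ n → Sat φ O (n ∷ ρ) → S n) → (∀ n → S n → Sat φ O (n ∷ ρ)) → Infinite S → Homogeneous p i S →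
    sol SRT22 p (λ n → χ φ (view tripleLayout f) (n ∷ ρ))
  readout-solution φ ρ i S sound complete =
    srt-solution {p} i S (λ n → χ≤1 φ (view tripleLayout f) (n ∷ ρ))
      (λ n e → sound n (Sat-cong (view-triple p q r) φ (n ∷ ρ) (χ-sound φ (view tripleLayout f) (n ∷ ρ) e)))
      (λ n s → χ-complete φ (view tripleLayout f) (n ∷ ρ) (Sat-cong (≈ᴼ-sym (view-triple p q r)) φ (n ∷ ρ) (complete n s)))

start-search : ∀ {i k O ρ} (φ : Form 3 (suc k)) →
  Sat (gateᶠ i) O ρ ⊎ (∃ λ i₀ → Sat φ O (i₀ ∷ ρ)) → ∃ λ i₀ → Sat (gateᶠ i ∨ᶠ φ) O (i₀ ∷ ρ)
start-search φ (inj₁ opened)   = 0 , inj₁ opened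
start-search φ (inj₂ (i₀ , s)) = i₀ , inj₂ s

open-gate : ∀ {i k O ρ} (t : Term 3 k) (φ : Form 3 (suc k)) →
  Sat (gateᶠ i ∨ᶠ ∃≤ t φ) O ρ → ∃ λ i₀ → Sat (gateᶠ i ∨ᶠ φ) O (i₀ ∷ ρ)
open-gate t φ (inj₁ opened)        = start-search φ (inj₁ opened)
open-gate t φ (inj₂ (i₀ , _ , s)) = start-search φ (inj₂ (i₀ , s))

module Neighbourhoods (p : Baire) (stable : Stable p) (q : Baire) where

  NoneOrInfinitely AtMostOneOrInfinitely : Set
  NoneOrInfinitely =
    ∀ u → u ∈S q → InfNbhd (graph p) q u ⊎ (∀ c → c ∈S q → ¬ Ex (graph p) u c)
  AtMostOneOrInfinitely =
    ∀ u → u ∈S q → InfNbhd (graph p) q u ⊎ (∀ c d → c ∈S q → Ex (graph p) u c → d ∈S q → Ex (graph p) u d → c ≡ d)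

  infinite-neighbourhood⇒limit-one : ∀ u → InfNbhd (graph p) q u → LimitOne p u
  infinite-neighbourhood⇒limit-one u inf =
    cofinally-adjacent⇒limit-one {p} stable u λ n → let (m , n≤m , _ , e) = inf n in m , n≤m , graph-edge p e

  neighbour⇒limit-one : NoneOrInfinitely → ∀ {u c} → q u ≡ 1 → q c ≡ 1 → Adj p u c → LimitOne p u
  neighbour⇒limit-one split {u} {c} qu qc adj with split u qu
  ... | inj₁ inf  = infinite-neighbourhood⇒limit-one u inf
  ... | inj₂ none = ⊥-elim (none c qc (Adj⇒graph-edge p adj))

  fork⇒limit-one : AtMostOneOrInfinitely →
    ∀ {u c d} → q u ≡ 1 → q c ≡ 1 → q d ≡ 1 → ¬ c ≡ d → Adj p u c → Adj p u d → LimitOne p u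
  fork⇒limit-one split {u} {c} {d} qu qc qd c≢d uc ud with split u qu
  ... | inj₁ inf = infinite-neighbourhood⇒limit-one u inf
  ... | inj₂ one = ⊥-elim (c≢d (one c d qc (Adj⇒graph-edge p uc) qd (Adj⇒graph-edge p ud)))

module _ {alternative : Form 3 4} {O : Oracles 3} {ρ : Vec ℕ 4} where

  gate-open : Sat (gateᶠ 0) O ρ → Sat (outputᶠ alternative) O ρ → Sat alternative O ρ
  gate-open _      (inj₁ (_ , s))    = s
  gate-open opened (inj₂ (shut , _)) = ⊥-elim (shut opened)

  gate-shut : ¬ Sat (gateᶠ 0) O ρ → Sat (outputᶠ alternative) O ρ → Sat greedyᶠ O ρ
  gate-shut shut (inj₁ (opened , _)) = ⊥-elim (shut opened)
  gate-shut _    (inj₂ (_ , s))      = s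

-- Ψ reads the witnesses it needs from unbounded searches, which the open gate stops at once.

Ψ-formula : ∀ {k} → Form 3 k → Code k
Ψ-formula = Compile.compileᶠ tripleLayout

seek : ∀ {k} → Form 3 (suc k) → Code k
seek φ = mu (Ψ-formula (¬ᶠ φ))

converges-single : ∀ {f k} {c : Code k} {xs v} → Converges f c xs v → Convergesⱽ f (c ∷ []) xs (v ∷ [])
converges-single {f} {xs = xs} c = converges-∷ f c (converges-[] f xs)

module EdgeReduction where

  seek-w : Code 0
  seek-w = seek (gateᶠ 0 ∨ᶠ edge≤ᶠ)
  seek-a : Code 1
  seek-a = seek (gateᶠ 0 ∨ᶠ ∃≤ x₁ edgeᶠ)
  seek-b : Code 1
  seek-b = seek (gateᶠ 0 ∨ᶠ edgeᶠ)

  aᶜ bᶜ : Code 1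
  aᶜ = comp seek-a (comp seek-w [] ∷ [])
  bᶜ = comp seek-b (aᶜ ∷ [])

  Θ Ψ : TuringFunctional
  Θ = Compile.compileᶠ pairLayout (¬ᶠ edge≤ᶠ)
  Ψ = comp (Ψ-formula (outputᶠ (inᶠ x₀))) (proj fz ∷ aᶜ ∷ bᶜ ∷ constᶜ 0 ∷ [])

  question : Baire → Baire → Baire
  question p q w = χ (¬ᶠ edge≤ᶠ) (view pairLayout ⟨ p , q ⟩) (w ∷ [])

  module _ (p q r : Baire) where
    open Readout p q r

    result : ℕ → ℕ → Baire
    result a b n = χ (outputᶠ (inᶠ x₀)) (view tripleLayout f) (n ∷ a ∷ b ∷ 0 ∷ [])

    Ψ-converges : ∀ {w a b} → Converges f seek-w [] w → Converges f seek-a (w ∷ []) a → Converges f seek-b (a ∷ []) b →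
      Ψ ⟦ f ⟧≡ result a b
    Ψ-converges cw ca cb n =
      converges-comp f (converges-∷ f (1 , refl) (converges-∷ f a↓ (converges-∷ f b↓ (converges-single (1 , refl)))))
        (compileᶠ-converges tripleLayout-μ-free (outputᶠ (inᶠ x₀)) f _)
      where
      open Compile tripleLayout using (compileᶠ-converges)
      a↓ = converges-comp f (converges-single (converges-comp f (converges-[] f (n ∷ [])) cw)) ca
      b↓ = converges-comp f (converges-single a↓) cb


    EdgeSearch : Set
    EdgeSearch = ∃ λ w → ∃ λ a → ∃ λ b → Converges f seek-w [] w × Converges f seek-a (w ∷ []) a ×
                                          Converges f seek-b (a ∷ []) b × (r 0 ≡ 1 ⊎ Sat edgeᶠ O (b ∷ a ∷ []))

    searches : r 0 ≡ 1 ⊎ (∃ λ w₀ → Sat edge≤ᶠ O (w₀ ∷ [])) → EdgeSearch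
    searches start = w , a , proj₁ B , proj₁ (proj₂ W) , proj₁ (proj₂ A) , proj₁ (proj₂ B) , proj₂ (proj₂ B)
      where
      w₀ = start-search {0} {O = O} {ρ = []} edge≤ᶠ start
      W  = find (gateᶠ 0 ∨ᶠ edge≤ᶠ) [] (proj₁ w₀) (proj₂ w₀)
      w  = proj₁ W
      a₀ = open-gate {0} {O = O} {ρ = w ∷ []} x₀ (∃≤ x₁ edgeᶠ) (proj₂ (proj₂ W))
      A  = find (gateᶠ 0 ∨ᶠ ∃≤ x₁ edgeᶠ) (w ∷ []) (proj₁ a₀) (proj₂ a₀)
      a  = proj₁ A
      b₀ = open-gate {0} {O = O} {ρ = a ∷ w ∷ []} x₁ edgeᶠ (proj₂ (proj₂ A))
      B  = find (gateᶠ 0 ∨ᶠ edgeᶠ) (a ∷ []) (proj₁ b₀) (proj₂ b₀)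

    edge-answer : sol LPO (question p q) r → Answered (r 0) (λ w → Sat edge≤ᶠ O (w ∷ []))
    edge-answer rs with lpo-answer edge≤ᶠ (view pairLayout ⟨ p , q ⟩) (λ w → w) r rs
    ... | inj₁ (yes₀ , w , s) = inj₁ (yes₀ , w , Sat-cong (view-pair p q) edge≤ᶠ (w ∷ []) s)
    ... | inj₂ (no₀ , none)   = inj₂ (no₀ , λ w s → none w (Sat-cong (≈ᴼ-sym (view-pair p q)) edge≤ᶠ (w ∷ []) s))

  module _ (p : Baire) (dp : dom SRT22 p) (q : Baire) (qs : sol wRSgr (graph p) q) (r : Baire) where
    open Readout p q r
    open Neighbourhoods p (proj₂ dp) q

    private
      q-infinite : InfiniteS q
      q-infinite = proj₁ (proj₂ (proj₂ qs))

      split : NoneOrInfinitely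
      split = proj₂ (proj₂ (proj₂ qs))

    edge-solution : r 0 ≡ 0 → ∀ {a b} → Sat edgeᶠ O (b ∷ a ∷ []) → sol SRT22 p (result p q r a b)
    edge-solution yes₀ {a} {b} (qa , qb , a<b , ab) =
      readout-solution (outputᶠ (inᶠ x₀)) (a ∷ b ∷ 0 ∷ []) 1 Chosen
        (λ n → gate-shut {inᶠ x₀} {O} {n ∷ a ∷ b ∷ 0 ∷ []} shut) (λ n c → inj₂ (shut , c))
        (chosen-infinite a<b qa qb ab q-infinite limit) (chosen-homogeneous a<b qa qb ab q-infinite limit)
      where
      open Greedy p q r (0 ∷ []) a b
      shut : ¬ r 0 ≡ 1
      shut no₀ = 0≢1+n (trans (sym yes₀) no₀)
      limit : ∀ z → Candidate z → LimitOne p z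
      limit z (qz , inj₂ za , _)   = neighbour⇒limit-one split qz qa za
      limit z (qz , inj₁ refl , _) = neighbour⇒limit-one split qa qb ab

    no-edge-solution : r 0 ≡ 1 → (∀ w → ¬ Sat edge≤ᶠ O (w ∷ [])) → ∀ a b → sol SRT22 p (result p q r a b)
    no-edge-solution no₀ none a b =
      readout-solution (outputᶠ (inᶠ x₀)) (a ∷ b ∷ 0 ∷ []) 0 (λ n → q n ≡ 1)
        (λ n → gate-open {inᶠ x₀} {O} {n ∷ a ∷ b ∷ 0 ∷ []} no₀) (λ n qn → inj₁ (no₀ , qn)) q-infinite homogeneous
      where
      homogeneous : Homogeneous p 0 (λ n → q n ≡ 1)
      homogeneous x y x<y qx qy = colour-zero {p} {x} {y} (proj₁ dp x y x<y)
        λ one → none y (x , <⇒≤ x<y , y , ≤-refl , qx , qy , x<y , inj₁ (x<y , one))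

    answer : sol LPO (question p q) r → Σ Baire λ h → Ψ ⟦ f ⟧≡ h × sol SRT22 p h
    answer rs = respond (searches p q r (unless-answered edges))
      where
      edges : Answered (r 0) (λ w → Sat edge≤ᶠ O (w ∷ []))
      edges = edge-answer p q r rs

      solution : ∀ a b → r 0 ≡ 1 ⊎ Sat edgeᶠ O (b ∷ a ∷ []) → Answered (r 0) (λ w → Sat edge≤ᶠ O (w ∷ [])) →
        sol SRT22 p (result p q r a b)
      solution a b (inj₁ no₀)  (inj₁ (yes₀ , _)) = ⊥-elim (0≢1+n (trans (sym yes₀) no₀))
      solution a b (inj₂ edge) (inj₁ (yes₀ , _)) = edge-solution yes₀ edge
      solution a b _           (inj₂ (no₀ , none)) = no-edge-solution no₀ none a b

      respond : EdgeSearch p q r → Σ Baire λ h → Ψ ⟦ f ⟧≡ h × sol SRT22 p h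
      respond (w , a , b , cw , ca , cb , edge) = result p q r a b , Ψ-converges p q r cw ca cb , solution a b edge edges

  reduction : SRT22 ≤W LPO ∗ wRSgr
  reduction = graphᶜ , Θ , Ψ , λ p dp → graph p , graph-computable p , graph-infinite p ,
    λ q qs → question p q , Compile.characteristic pairLayout pairLayout-μ-free (¬ᶠ edge≤ᶠ) ⟨ p , q ⟩ , tt ,
    λ r rs → answer p dp q qs r rs

below-sum : ∀ a b c d → a ≤ a + b + c + d × b ≤ a + b + c + d × c ≤ a + b + c + d × d ≤ a + b + c + d
below-sum a b c d =
  ≤-trans (m≤m+n a b) ab+ , ≤-trans (m≤n+m b a) ab+ , ≤-trans (m≤n+m c (a + b)) (m≤m+n _ d) , m≤n+m d _
  where
  ab+ : a + b ≤ a + b + c + d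
  ab+ = ≤-trans (m≤m+n (a + b) c) (m≤m+n _ d)

twice : ∀ w → 2 * w ≡ w + w
twice w = cong (w +_) (+-identityʳ w)

module PathReduction where

  seek-w₁ : Code 0
  seek-w₁ = seek (gateᶠ 0 ∨ᶠ path≤ᶠ)
  seek-a : Code 1
  seek-a = seek (gateᶠ 0 ∨ᶠ ∃≤ x₁ (∃≤ x₂ (∃≤ x₃ pathᶠ)))
  seek-b : Code 2
  seek-b = seek (gateᶠ 0 ∨ᶠ ∃≤ x₂ (∃≤ x₃ pathᶠ))
  seek-w₂ : Code 0
  seek-w₂ = seek (gateᶠ 1 ∨ᶠ fork≤ᶠ)
  seek-v : Code 1
  seek-v = seek (gateᶠ 1 ∨ᶠ ∃≤ x₁ (∃≤ x₂ forkᶠ))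

  w₁ᶜ aᶜ bᶜ w₂ᶜ vᶜ : Code 1
  w₁ᶜ = comp seek-w₁ []
  aᶜ  = comp seek-a (w₁ᶜ ∷ [])
  bᶜ  = comp seek-b (aᶜ ∷ w₁ᶜ ∷ [])
  w₂ᶜ = comp seek-w₂ []
  vᶜ  = comp seek-v (w₂ᶜ ∷ [])

  -- in the context n: a path below n / 2 if n is even, a fork below n / 2 if n is odd
  questionᶠ : Form 3 1
  questionᶠ = ∃≤ x₀ ((x₁ ≐ x₀ ⊕ x₀ ∧ᶠ path≤ᶠ) ∨ᶠ (x₁ ≐ succᵗ (x₀ ⊕ x₀) ∧ᶠ fork≤ᶠ))

  Θ Ψ : TuringFunctional
  Θ = Compile.compileᶠ pairLayout (¬ᶠ questionᶠ)
  Ψ = comp (Ψ-formula (outputᶠ independentᶠ)) (proj fz ∷ aᶜ ∷ bᶜ ∷ vᶜ ∷ [])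

  module _ (p q r : Baire) where
    open Readout p q r

    result : ℕ → ℕ → ℕ → Baire
    result a b v n = χ (outputᶠ independentᶠ) (view tripleLayout f) (n ∷ a ∷ b ∷ v ∷ [])

    Ψ-converges : ∀ {w₁ a b w₂ v} → Converges f seek-w₁ [] w₁ → Converges f seek-a (w₁ ∷ []) a →
      Converges f seek-b (a ∷ w₁ ∷ []) b → Converges f seek-w₂ [] w₂ → Converges f seek-v (w₂ ∷ []) v →
      Ψ ⟦ f ⟧≡ result a b v
    Ψ-converges cw₁ ca cb cw₂ cv n =
      converges-comp f (converges-∷ f (1 , refl) (converges-∷ f a↓ (converges-∷ f b↓ (converges-single v↓))))
        (compileᶠ-converges tripleLayout-μ-free (outputᶠ independentᶠ) f _)
      where
      open Compile tripleLayout using (compileᶠ-converges)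
      w₁↓ = converges-comp f (converges-[] f (n ∷ [])) cw₁
      a↓  = converges-comp f (converges-single w₁↓) ca
      b↓  = converges-comp f (converges-∷ f a↓ (converges-single w₁↓)) cb
      v↓  = converges-comp f (converges-single (converges-comp f (converges-[] f (n ∷ [])) cw₂)) cv

    Path : ℕ → ℕ → Set
    Path a b = ∃ λ c → ∃ λ d → Sat pathᶠ O (d ∷ c ∷ b ∷ a ∷ [])

    Fork : ℕ → Set
    Fork v = ∃ λ c → ∃ λ d → Sat forkᶠ O (d ∷ c ∷ v ∷ [])

    PathSearch : Set
    PathSearch = ∃ λ w → ∃ λ a → ∃ λ b → Converges f seek-w₁ [] w × Converges f seek-a (w ∷ []) a ×
                                          Converges f seek-b (a ∷ w ∷ []) b × (r 0 ≡ 1 ⊎ Path a b)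

    path-search : r 0 ≡ 1 ⊎ (∃ λ w₀ → Sat path≤ᶠ O (w₀ ∷ [])) → PathSearch
    path-search start = w , a , b , proj₁ (proj₂ W) , proj₁ (proj₂ A) , proj₁ (proj₂ B) , found (proj₂ (proj₂ B))
      where
      w₀ = start-search {0} {O = O} {ρ = []} path≤ᶠ start
      W  = find (gateᶠ 0 ∨ᶠ path≤ᶠ) [] (proj₁ w₀) (proj₂ w₀)
      w  = proj₁ W
      a₀ = open-gate {0} {O = O} {ρ = w ∷ []} x₀ (∃≤ x₁ (∃≤ x₂ (∃≤ x₃ pathᶠ))) (proj₂ (proj₂ W))
      A  = find (gateᶠ 0 ∨ᶠ ∃≤ x₁ (∃≤ x₂ (∃≤ x₃ pathᶠ))) (w ∷ []) (proj₁ a₀) (proj₂ a₀)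
      a  = proj₁ A
      b₀ = open-gate {0} {O = O} {ρ = a ∷ w ∷ []} x₁ (∃≤ x₂ (∃≤ x₃ pathᶠ)) (proj₂ (proj₂ A))
      B  = find (gateᶠ 0 ∨ᶠ ∃≤ x₂ (∃≤ x₃ pathᶠ)) (a ∷ w ∷ []) (proj₁ b₀) (proj₂ b₀)
      b  = proj₁ B
      found : Sat (gateᶠ 0 ∨ᶠ ∃≤ x₂ (∃≤ x₃ pathᶠ)) O (b ∷ a ∷ w ∷ []) → r 0 ≡ 1 ⊎ Path a b
      found (inj₁ opened)              = inj₁ opened
      found (inj₂ (c , _ , d , _ , s)) = inj₂ (c , d , s)

    ForkSearch : Set
    ForkSearch = ∃ λ w → ∃ λ v → Converges f seek-w₂ [] w × Converges f seek-v (w ∷ []) v × (r 1 ≡ 1 ⊎ Fork v)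

    fork-search : r 1 ≡ 1 ⊎ (∃ λ w₀ → Sat fork≤ᶠ O (w₀ ∷ [])) → ForkSearch
    fork-search start = w , v , proj₁ (proj₂ W) , proj₁ (proj₂ V) , found (proj₂ (proj₂ V))
      where
      w₀ = start-search {1} {O = O} {ρ = []} fork≤ᶠ start
      W  = find (gateᶠ 1 ∨ᶠ fork≤ᶠ) [] (proj₁ w₀) (proj₂ w₀)
      w  = proj₁ W
      v₀ = open-gate {1} {O = O} {ρ = w ∷ []} x₀ (∃≤ x₁ (∃≤ x₂ forkᶠ)) (proj₂ (proj₂ W))
      V  = find (gateᶠ 1 ∨ᶠ ∃≤ x₁ (∃≤ x₂ forkᶠ)) (w ∷ []) (proj₁ v₀) (proj₂ v₀)
      v  = proj₁ V
      found : Sat (gateᶠ 1 ∨ᶠ ∃≤ x₁ (∃≤ x₂ forkᶠ)) O (v ∷ w ∷ []) → r 1 ≡ 1 ⊎ Fork v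
      found (inj₁ opened)              = inj₁ opened
      found (inj₂ (c , _ , d , _ , s)) = inj₂ (c , d , s)

  module _ {O : Oracles 3} where

    question-even : ∀ w → Sat questionᶠ O (2 * w ∷ []) → Sat path≤ᶠ O (w ∷ [])
    question-even w (k , _ , inj₁ (e , s)) rewrite *-cancelˡ-≡ w k 2 (trans e (sym (twice k))) = s
    question-even w (k , _ , inj₂ (e , _)) = ⊥-elim (even≢odd w k (trans e (cong suc (sym (twice k)))))

    question-odd : ∀ w → Sat questionᶠ O (suc (2 * w) ∷ []) → Sat fork≤ᶠ O (w ∷ [])
    question-odd w (k , _ , inj₁ (e , _)) = ⊥-elim (even≢odd k w (trans (twice k) (sym e)))
    question-odd w (k , _ , inj₂ (e , s))
      rewrite *-cancelˡ-≡ w k 2 (trans (suc-injective e) (sym (twice k))) = s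

    path-question : ∀ w → Sat path≤ᶠ O (w ∷ []) → Sat questionᶠ O (2 * w ∷ [])
    path-question w s = w , m≤m+n w _ , inj₁ (twice w , s)

    fork-question : ∀ w → Sat fork≤ᶠ O (w ∷ []) → Sat questionᶠ O (suc (2 * w) ∷ [])
    fork-question w s = w , ≤-trans (m≤m+n w _) (n≤1+n _) , inj₂ (cong suc (twice w) , s)

  question : Baire → Baire → Baire
  question p q n = χ (¬ᶠ questionᶠ) (view pairLayout ⟨ p , q ⟩) (n ∷ [])

  module _ (p q r : Baire) where
    private
      O O′ : Oracles 3
      O  = oracles p q r
      O′ = view pairLayout ⟨ p , q ⟩
      to : ∀ {k} (φ : Form 3 k) ρ → Sat φ O′ ρ → Sat φ (oracles p q p) ρ
      to φ = Sat-cong (view-pair p q) φ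
      from : ∀ {k} (φ : Form 3 k) ρ → Sat φ (oracles p q p) ρ → Sat φ O′ ρ
      from φ = Sat-cong (≈ᴼ-sym (view-pair p q)) φ

    path-answer : sol LPO (π₀ (question p q)) (π₀ r) → Answered (r 0) (λ w → Sat path≤ᶠ O (w ∷ []))
    path-answer rs with lpo-answer questionᶠ O′ (2 *_) (π₀ r) rs
    ... | inj₁ (yes₀ , w , s) = inj₁ (yes₀ , w , question-even {oracles p q p} w (to questionᶠ (2 * w ∷ []) s))
    ... | inj₂ (no₀ , none)   = inj₂ (no₀ , λ w s → none w (from questionᶠ (2 * w ∷ []) (path-question {oracles p q p} w s)))

    fork-answer : sol LPO (π₁ (question p q)) (π₁ r) → Answered (r 1) (λ w → Sat fork≤ᶠ O (w ∷ []))
    fork-answer rs with lpo-answer questionᶠ O′ (suc ∘ (2 *_)) (π₁ r) rs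
    ... | inj₁ (yes₁ , w , s) = inj₁ (yes₁ , w , question-odd {oracles p q p} w (to questionᶠ (suc (2 * w) ∷ []) s))
    ... | inj₂ (no₁ , none)   =
      inj₂ (no₁ , λ w s → none w (from questionᶠ (suc (2 * w) ∷ []) (fork-question {oracles p q p} w s)))

  module _ (p : Baire) (dp : dom SRT22 p) (q : Baire) (qs : sol wRSg (graph p) q) (r : Baire) where
    open Readout p q r
    open Neighbourhoods p (proj₂ dp) q

    private
      q-infinite : InfiniteS q
      q-infinite = proj₁ (proj₂ (proj₂ qs))

      split : AtMostOneOrInfinitely
      split = proj₂ (proj₂ (proj₂ qs))

    path-below : ∀ {a b c d} → Sat pathᶠ O (d ∷ c ∷ b ∷ a ∷ []) → ∃ λ w → Sat path≤ᶠ O (w ∷ [])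
    path-below {a} {b} {c} {d} s =
      let (a≤ , b≤ , c≤ , d≤) = below-sum a b c d in a + b + c + d , a , a≤ , b , b≤ , c , c≤ , d , d≤ , s

    fork-below : ∀ {v c d} → Sat forkᶠ O (d ∷ c ∷ v ∷ []) → ∃ λ w → Sat fork≤ᶠ O (w ∷ [])
    fork-below {v} {c} {d} s =
      let (v≤ , c≤ , d≤ , _) = below-sum v c d 0 in v + c + d + 0 , v , v≤ , c , c≤ , d , d≤ , s

    path-solution : r 0 ≡ 0 → ∀ {a b} v → Path p q r a b → sol SRT22 p (result p q r a b v)
    path-solution yes₀ {a} {b} v (c , d , qa , qb , qc , qd , a<b , ab , ac , c≢b , bd , d≢a) =
      readout-solution (outputᶠ independentᶠ) (a ∷ b ∷ v ∷ []) 1 Chosen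
        (λ n → gate-shut {independentᶠ} {O} {n ∷ a ∷ b ∷ v ∷ []} shut) (λ n c → inj₂ (shut , c))
        (chosen-infinite a<b qa qb ab q-infinite limit) (chosen-homogeneous a<b qa qb ab q-infinite limit)
      where
      open Greedy p q r (v ∷ []) a b
      shut : ¬ r 0 ≡ 1
      shut no₀ = 0≢1+n (trans (sym yes₀) no₀)
      limit : ∀ z → Candidate z → LimitOne p z
      limit z (qz , inj₁ refl , _)       = fork⇒limit-one split qa qb qc (c≢b ∘ sym) ab ac
      limit z (qz , inj₂ za , inj₁ refl) = fork⇒limit-one split qb qa qd (d≢a ∘ sym) za bd
      limit z (qz , inj₂ za , inj₂ zb)   = fork⇒limit-one split qz qa qb (<⇒≢ a<b) za zb

    module _ (no-path : ∀ w → ¬ Sat path≤ᶠ O (w ∷ [])) where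

      -- An infinite neighbourhood at u ≠ v would give a fork at u, or, with a fork at v, a late
      -- common neighbour y of u and v, and with it the path c - v - y - u for a neighbour c ≠ y of v.
      finite-neighbourhood : ∀ v → (∀ w → ¬ Sat fork≤ᶠ O (w ∷ [])) ⊎ Fork p q r v →
        ∀ u → q u ≡ 1 → ¬ u ≡ v → ¬ InfNbhd (graph p) q u
      finite-neighbourhood v (inj₁ no-fork) u qu _ inf with inf 0
      ... | m₁ , _ , qm₁ , e₁ with inf (suc m₁)
      ...   | m₂ , m₁<m₂ , qm₂ , e₂ =
        no-fork _ (proj₂ (fork-below {u} {m₁} {m₂} (qu , qm₁ , qm₂ , <⇒≢ m₁<m₂ , graph-edge p e₁ , graph-edge p e₂)))
      finite-neighbourhood v (inj₂ (c , d , qv , qc , qd , c≢d , vc , vd)) u qu u≢v inf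
        with fork⇒limit-one split qv qc qd c≢d vc vd | infinite-neighbourhood⇒limit-one u inf
      ... | sv , limit-v | su , limit-u with q-infinite (sv + su + suc u + suc v)
      ...   | y , far , qy =
        no-path _ (proj₂ (path-below {v} {y} {c′} {u} (qv , qy , qc′ , qu , v<y , vy , vc′ , c′≢y , Adj-sym p uy , u≢v)))
        where
        bounds = below-sum sv su (suc u) (suc v)
        v<y = ≤-trans (proj₂ (proj₂ (proj₂ bounds))) far
        u<y = ≤-trans (proj₁ (proj₂ (proj₂ bounds))) far
        vy : Adj p v y
        vy = inj₁ (v<y , limit-v y (≤-trans (proj₁ bounds) far) v<y)
        uy : Adj p u y
        uy = inj₁ (u<y , limit-u y (≤-trans (proj₁ (proj₂ bounds)) far) u<y)
        other : Dec (c ≡ y) → ∃ λ c′ → q c′ ≡ 1 × Adj p v c′ × ¬ c′ ≡ y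
        other (yes refl) = d , qd , vd , c≢d ∘ sym
        other (no c≢y)   = c , qc , vc , c≢y
        c′  = proj₁ (other (c ≟ y))
        qc′ = proj₁ (proj₂ (other (c ≟ y)))
        vc′ = proj₁ (proj₂ (proj₂ (other (c ≟ y))))
        c′≢y = proj₂ (proj₂ (proj₂ (other (c ≟ y))))

      independent-solution : r 0 ≡ 1 → ∀ a b v → (∀ w → ¬ Sat fork≤ᶠ O (w ∷ [])) ⊎ Fork p q r v →
        sol SRT22 p (result p q r a b v)
      independent-solution no₀ a b v forks =
        readout-solution (outputᶠ independentᶠ) (a ∷ b ∷ v ∷ []) 0 Independent
          (λ n → gate-open {independentᶠ} {O} {n ∷ a ∷ b ∷ v ∷ []} no₀) (λ n s → inj₁ (no₀ , s))
          (independent-infinite q-infinite one-neighbour) (independent-homogeneous (proj₁ dp))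
        where
        open Independent p q r v
        one-neighbour : ∀ u → Rest u → ∀ c d → Rest c → Rest d → Adj p u c → Adj p u d → c ≡ d
        one-neighbour u (qu , u≢v) c d (qc , _) (qd , _) uc ud with split u qu
        ... | inj₁ inf = ⊥-elim (finite-neighbourhood v forks u qu u≢v inf)
        ... | inj₂ one = one c d qc (Adj⇒graph-edge p {u} {c} uc) qd (Adj⇒graph-edge p {u} {d} ud)

    answer : sol (LPO ×P LPO) (question p q) r → Σ Baire λ h → Ψ ⟦ f ⟧≡ h × sol SRT22 p h
    answer (rs₀ , rs₁) = respond (path-search p q r (unless-answered paths)) (fork-search p q r (unless-answered forks))
      where
      paths : Answered (r 0) (λ w → Sat path≤ᶠ O (w ∷ []))
      paths = path-answer p q r rs₀
      forks : Answered (r 1) (λ w → Sat fork≤ᶠ O (w ∷ []))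
      forks = fork-answer p q r rs₁

      solution : ∀ a b v → r 0 ≡ 1 ⊎ Path p q r a b → r 1 ≡ 1 ⊎ Fork p q r v →
        Answered (r 0) (λ w → Sat path≤ᶠ O (w ∷ [])) → Answered (r 1) (λ w → Sat fork≤ᶠ O (w ∷ [])) →
        sol SRT22 p (result p q r a b v)
      solution a b v (inj₁ no₀)   _ (inj₁ (yes₀ , _)) _ = ⊥-elim (0≢1+n (trans (sym yes₀) no₀))
      solution a b v (inj₂ path)  _ (inj₁ (yes₀ , _)) _ = path-solution yes₀ v path
      solution a b v _ _           (inj₂ (no₀ , none)) (inj₂ (_ , no-fork)) =
        independent-solution none no₀ a b v (inj₁ no-fork)
      solution a b v _ (inj₁ no₁)  (inj₂ _) (inj₁ (yes₁ , _)) = ⊥-elim (0≢1+n (trans (sym yes₁) no₁))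
      solution a b v _ (inj₂ fork) (inj₂ (no₀ , none)) (inj₁ _) = independent-solution none no₀ a b v (inj₂ fork)

      respond : PathSearch p q r → ForkSearch p q r → Σ Baire λ h → Ψ ⟦ f ⟧≡ h × sol SRT22 p h
      respond (w₁ , a , b , cw₁ , ca , cb , path) (w₂ , v , cw₂ , cv , fork) =
        result p q r a b v , Ψ-converges p q r cw₁ ca cb cw₂ cv , solution a b v path fork paths forks

  reduction : SRT22 ≤W (LPO ×P LPO) ∗ wRSg
  reduction = graphᶜ , Θ , Ψ , λ p dp → graph p , graph-computable p , graph-infinite p ,
    λ q qs → question p q , Compile.characteristic pairLayout pairLayout-μ-free (¬ᶠ questionᶠ) ⟨ p , q ⟩ , (tt , tt) ,
    λ r rs → answer p dp q qs r rs

theorem6p14 : (SRT22 ≤W LPO ∗ wRSgr) × (SRT22 ≤W (LPO ×P LPO) ∗ wRSg)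
theorem6p14 = EdgeReduction.reduction , PathReduction.reduction
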